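{- For positive integers $k_1,\dots,k_l$ with $k_1\ge2$, $$Li^{t}_{(k_1,\dots,k_l); q}(q) = \sum_{a_1=2}^{k_1}\sum_{a_2=1}^{k_2} \cdots \sum_{a_l=1}^{k_l}\binom{k_1-2}{a_1-2}\prod_{j=2}^{l}\binom{k_j-1}{a_j-1} (1-q)^{\sum_{i=1}^{l}(k_i-a_i)}\zeta^{t}_{q}(a_1, a_2, \ldots, a_l).$$
   Context: $q$ is a formal parameter, $[n]=(1-q^n)/(1-q)$. For an index $\mathbf k=(k_1,\dots,k_l)$ of positive integers, $Li_{\mathbf k;q}(z)=\sum_{m_1>\cdots>m_l\ge1}\frac{z^{m_1}}{[m_1]^{k_1}\cdots[m_l]^{k_l}}$, and $Li^t_{\mathbf k;q}(z)=\sum_{\mathbf p}Li_{\mathbf p;q}(z)t^{l-\mathrm{dep}(\mathbf p)}$, $\mathbf p$ running over indices $(k_1\,\square\cdots\square\,k_l)$ with each $\square$ filled by ``$,$'' or ``$+$''. For $k_1\ge2$, $\zeta_q(\mathbf k)=\sum_{m_1>\cdots>m_l\ge1}\prod_j q^{(k_j-1)m_j}/[m_j]^{k_j}$ and $\zeta^t_q(\mathbf k)=\sum_{\mathbf p}(1-q)^{\mathrm{wt}(\mathbf k)-\mathrm{wt}(\mathbf p)}\zeta_q(\mathbf p)t^{l-\mathrm{dep}(\mathbf p)}$, where here $\mathbf p$ runs over indices $(k_1\,\square\cdots\square\,k_l)$ with each $\square$ filled by ``$,$'', ``$+$'' or ``$-1+$'' (neighbouring $a,b$ replaced by $a+b-1$);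 $\mathrm{wt}$ is the sum of entries and $\mathrm{dep}$ the length. -}

module Defs where

open import Data.Nat as ℕ using (ℕ; zero; suc; _∸_; _≡ᵇ_)
open import Data.Integer as ℤ using (ℤ; +_; -_)
open import Data.List using (List; []; _∷_; map; concatMap; length; foldr; upTo; zipWith)
open import Data.Bool using (if_then_else_)
open import Data.Nat.Combinatorics using (_C_)
open import Data.Nat.Divisibility using (_∣?_)
open import Relation.Nullary.Decidable using (does)

-- Formal power series in q with integer coefficients: n ↦ coeff of q^n
PS : Set
PS = ℕ → ℤ

0ₛ : PS
0ₛ _ = + 0

1ₛ : PS
1ₛ zero    = + 1
1ₛ (suc _) = + 0

_⊕_ : PS → PS → PS
(f ⊕ g) n = f n ℤ.+ g n

negₛ : PS → PS
negₛ f n = - f n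

sumℤ : ℕ → (ℕ → ℤ) → ℤ
sumℤ zero    f = + 0
sumℤ (suc n) f = sumℤ n f ℤ.+ f n

_⊛_ : PS → PS → PS
(f ⊛ g) n = sumℤ (suc n) (λ i → f i ℤ.* g (n ∸ i))

_^ₛ_ : PS → ℕ → PS
f ^ₛ zero  = 1ₛ
f ^ₛ suc n = f ⊛ (f ^ₛ n)

_·ₛ_ : ℕ → PS → PS
(c ·ₛ f) n = + c ℤ.* f n

Σ< : ℕ → (ℕ → PS) → PS
Σ< zero    f = 0ₛ
Σ< (suc n) f = Σ< n f ⊕ f n

sumPS : List PS → PS
sumPS = foldr _⊕_ 0ₛ

qpow : ℕ → PS
qpow m n = if m ≡ᵇ n then + 1 else + 0

oneMinusQ : PS
oneMinusQ = 1ₛ ⊕ negₛ (qpow 1)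

-- 1/(1-q^m) = Σ_i q^{m i}   (used only for m ≥ 1)
geom : ℕ → PS
geom m n = if does (m ∣? n) then + 1 else + 0

-- 1/[m] = (1-q)/(1-q^m)   (used only for m ≥ 1)
invBr : ℕ → PS
invBr m = oneMinusQ ⊛ geom m

-- Nested sums over m_1 > m_2 > ... > m_l ≥ 1.
-- chain w (p_2,...,p_l) M = Σ_{M > m_2 > ... > m_l ≥ 1} Π_j w p_j m_j
chain : (ℕ → ℕ → PS) → List ℕ → ℕ → PS
chain w []       M = 1ₛ
chain w (p ∷ ps) M = Σ< (M ∸ 1) (λ i → w p (suc i) ⊛ chain w ps (suc i))

wLi : ℕ → ℕ → PS
wLi p m = invBr m ^ₛ p

wZ : ℕ → ℕ → PS
wZ p m = qpow ((p ∸ 1) ℕ.* m) ⊛ (invBr m ^ₛ p)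

-- Li_{p;q}(q) = Σ_{m_1>...>m_l≥1} q^{m_1} / Π [m_j]^{p_j}.
-- The term with outermost summation variable m_1 is O(q^{m_1}), so the
-- coefficient of q^N of the (q-adically convergent) series only involves
-- m_1 ≤ N; we compute it from that finite partial sum.
Li : List ℕ → PS
Li []       = 1ₛ
Li (p ∷ ps) N =
  Σ< N (λ i → qpow (suc i) ⊛ (wLi p (suc i) ⊛ chain wLi ps (suc i))) N

-- ζ_q(p) = Σ_{m_1>...>m_l≥1} Π q^{(p_j-1)m_j}/[m_j]^{p_j}   (p_1 ≥ 2).
-- Again the m_1-term is O(q^{m_1}) when p_1 ≥ 2, so coefficient N only
-- involves m_1 ≤ N.
ζq : List ℕ → PS
ζq []       = 1ₛ
ζq (p ∷ ps) N =
  Σ< N (λ i → wZ p (suc i) ⊛ chain wZ ps (suc i)) N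

-- Fillings of the boxes in (k_1 □ k_2 □ ... □ k_l); one list entry per filling.

extLi : ℕ → List ℕ → List (List ℕ)
extLi k []      = []
extLi k (h ∷ r) = (k ∷ h ∷ r) ∷ ((k ℕ.+ h) ∷ r) ∷ []

-- □ ∈ { "," , "+" }
fillLi : ℕ → List ℕ → List (List ℕ)
fillLi k []        = (k ∷ []) ∷ []
fillLi k (k' ∷ ks) = concatMap (extLi k) (fillLi k' ks)

extZ : ℕ → List ℕ → List (List ℕ)
extZ k []      = []
extZ k (h ∷ r) = (k ∷ h ∷ r) ∷ ((k ℕ.+ h) ∷ r) ∷ ((k ℕ.+ h ∸ 1) ∷ r) ∷ []

-- □ ∈ { "," , "+" , "-1+" }
fillZ : ℕ → List ℕ → List (List ℕ)
fillZ k []        = (k ∷ []) ∷ []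
fillZ k (k' ∷ ks) = concatMap (extZ k) (fillZ k' ks)

wt : List ℕ → ℕ
wt = foldr ℕ._+_ 0

-- Series in q and t: d ↦ (coefficient of t^d, a power series in q)
TPS : Set
TPS = ℕ → PS

-- Li^t_{(k_1,...,k_l);q}(q) = Σ_p Li_{p;q}(q) t^{l - dep p}
LiT : ℕ → List ℕ → TPS
LiT k ks d = sumPS (map term (fillLi k ks))
  where
  term : List ℕ → PS
  term p = if (length (k ∷ ks) ∸ length p) ≡ᵇ d then Li p else 0ₛ

-- ζ^t_q(k) = Σ_p (1-q)^{wt k - wt p} ζ_q(p) t^{l - dep p}
ζT : ℕ → List ℕ → TPS
ζT k ks d = sumPS (map term (fillZ k ks))
  where
  term : List ℕ → PS
  term p = if (length (k ∷ ks) ∸ length p) ≡ᵇ d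
           then (oneMinusQ ^ₛ (wt (k ∷ ks) ∸ wt p)) ⊛ ζq p
           else 0ₛ

choices : List ℕ → List (List ℕ)
choices []       = [] ∷ []
choices (k ∷ ks) = concatMap (λ i → map (suc i ∷_) (choices ks)) (upTo k)

binProd : List ℕ → List ℕ → ℕ
binProd ks as = foldr ℕ._*_ 1 (zipWith (λ k a → (k ∸ 1) C (a ∸ 1)) ks as)

expSum : List ℕ → List ℕ → ℕ
expSum ks as = foldr ℕ._+_ 0 (zipWith _∸_ ks as)

rhs : ℕ → List ℕ → TPS
rhs k ks d =
  sumPS (concatMap (λ i → map (term (2 ℕ.+ i)) (choices ks)) (upTo (k ∸ 1)))
  where
  term : ℕ → List ℕ → PS
  term a as =
    (((k ∸ 2) C (a ∸ 2)) ℕ.* binProd ks as)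
      ·ₛ ((oneMinusQ ^ₛ ((k ∸ a) ℕ.+ expSum ks as)) ⊛ ζT a as d)

module Submission where

-- Idea.  Fix the outermost summation variable m of all nested sums and write B = 1/[m].
-- From 1/(1-q^m) = 1 + q^m/(1-q^m) we get B = q^m B + (1-q) (invBr-unfold).  With the
-- binomial theorem this writes the Li-weight B^k as a combination of the ζ-weights
-- q^{(a-1)m} B^a (wLi-expand, q-wLi-expand), and it shows that the product of two ζ-weights
-- at the same variable is the "+" term plus (1-q) times the "-1+" term (wZ-merge) -- which is
-- exactly how the fillings of ζ^t arise.  Hence the t-graded sums over fillings with
-- outermost variable m factor as weight × inner sum, for Li (LiAt-unfold) and for ζ
-- (ζAt-unfold).  Induction on the index then gives the identity for the inner sums
-- (below-expansion) and for fixed m (lemma3p12-at); summing over m ≤ N, and checking that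
-- the q^N-coefficients of both sides only involve m ≤ N, proves the theorem.

open import Defs
open import Data.Nat using (ℕ; _≤_)
open import Data.List using (List)
open import Data.List.Relation.Unary.All using (All)
open import Relation.Binary.PropositionalEquality using (_≡_)

open import Level using (0ℓ)
open import Data.Nat as ℕ using (zero; suc; _∸_; _<_; z≤n; s≤s; _≡ᵇ_)
import Data.Nat.Properties as ℕP
open import Data.Nat.Divisibility using (_∣?_; _∣0; ∣m+n∣m⇒∣n; ∣m∣n⇒∣m+n; ∣-refl; >⇒∤)
open import Data.Integer as ℤ using (ℤ; +_)
import Data.Integer.Properties as ℤP
open import Data.Product using (_×_; _,_)
open import Data.Fin using (Fin; toℕ) renaming (zero to fzero; suc to fsuc)
open import Data.List using ([]; _∷_; map; concatMap; length; upTo; applyUpTo; _++_)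
open import Data.List.Relation.Unary.All using ([]; _∷_)
import Data.List.Relation.Unary.All as All
open import Data.List.Relation.Unary.All.Properties using (concat⁺; map⁺; applyUpTo⁺₂)
open import Data.Empty using (⊥)
open import Data.Bool using (Bool; true; false; if_then_else_)
open import Data.Nat.Combinatorics using (_C_)
open import Relation.Binary.PropositionalEquality
  using (refl; sym; trans; cong; cong₂; subst; module ≡-Reasoning)
open import Relation.Nullary using (yes; no)
open import Relation.Nullary.Decidable using (dec-true; dec-false; does-⇔)
open import Function using (_∘_; mk⇔)
open import Algebra.Bundles using (CommutativeSemiring)
open import Algebra.Structures using (IsCommutativeMonoid)
open import Algebra.Structures.Biased using (isCommutativeMonoidˡ; isCommutativeSemiringʳ)
import Algebra.Properties.CommutativeSemigroup as CommSemigroupProperties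
import Relation.Binary.Reasoning.Setoid as SetoidReasoning
import Algebra.Properties.CommutativeSemiring.Binomial as BinomialTheorem
import Algebra.Definitions.RawSemiring as RawSemiringDefinitions

module ℤ+ = CommSemigroupProperties ℤP.+-commutativeSemigroup

sumℤ-cong : ∀ n {f g : ℕ → ℤ} → (∀ i → i < n → f i ≡ g i) → sumℤ n f ≡ sumℤ n g
sumℤ-cong zero    eq = refl
sumℤ-cong (suc n) eq =
  cong₂ ℤ._+_ (sumℤ-cong n (λ i i<n → eq i (ℕP.m<n⇒m<1+n i<n))) (eq n ℕP.≤-refl)

sumℤ-zero : ∀ n {f : ℕ → ℤ} → (∀ i → i < n → f i ≡ + 0) → sumℤ n f ≡ + 0
sumℤ-zero zero    eq = refl
sumℤ-zero (suc n) eq =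
  cong₂ ℤ._+_ (sumℤ-zero n (λ i i<n → eq i (ℕP.m<n⇒m<1+n i<n))) (eq n ℕP.≤-refl)

sumℤ-+ : ∀ n (f g : ℕ → ℤ) → sumℤ n (λ i → f i ℤ.+ g i) ≡ sumℤ n f ℤ.+ sumℤ n g
sumℤ-+ zero    f g = refl
sumℤ-+ (suc n) f g =
  trans (cong (ℤ._+ (f n ℤ.+ g n)) (sumℤ-+ n f g)) (ℤ+.interchange (sumℤ n f) (sumℤ n g) (f n) (g n))

sumℤ-*ˡ : ∀ n (c : ℤ) (f : ℕ → ℤ) → sumℤ n (λ i → c ℤ.* f i) ≡ c ℤ.* sumℤ n f
sumℤ-*ˡ zero    c f = sym (ℤP.*-zeroʳ c)
sumℤ-*ˡ (suc n) c f =
  trans (cong (ℤ._+ (c ℤ.* f n)) (sumℤ-*ˡ n c f)) (sym (ℤP.*-distribˡ-+ c _ _))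

sumℤ-*ʳ : ∀ n (c : ℤ) (f : ℕ → ℤ) → sumℤ n (λ i → f i ℤ.* c) ≡ sumℤ n f ℤ.* c
sumℤ-*ʳ n c f =
  trans (sumℤ-cong n (λ i _ → ℤP.*-comm (f i) c)) (trans (sumℤ-*ˡ n c f) (ℤP.*-comm c _))

sumℤ-unfoldˡ : ∀ n (f : ℕ → ℤ) → sumℤ (suc n) f ≡ f 0 ℤ.+ sumℤ n (f ∘ suc)
sumℤ-unfoldˡ zero    f = trans (ℤP.+-identityˡ (f 0)) (sym (ℤP.+-identityʳ (f 0)))
sumℤ-unfoldˡ (suc n) f = trans (cong (ℤ._+ f (suc n)) (sumℤ-unfoldˡ n f)) (ℤP.+-assoc (f 0) _ _)

sumℤ-reverse : ∀ n (f : ℕ → ℤ) → sumℤ n f ≡ sumℤ n (λ i → f (n ∸ suc i))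
sumℤ-reverse zero    f = refl
sumℤ-reverse (suc n) f = begin
    sumℤ n f ℤ.+ f n                                    ≡⟨ cong (ℤ._+ f n) (sumℤ-reverse n f) ⟩
    sumℤ n (λ i → f (n ∸ suc i)) ℤ.+ f n                ≡⟨ ℤP.+-comm _ (f n) ⟩
    f n ℤ.+ sumℤ n (λ i → f (n ∸ suc i))                ≡⟨ sym (sumℤ-unfoldˡ n (λ i → f (n ∸ i))) ⟩
    sumℤ (suc n) (λ i → f (n ∸ i))                      ∎
  where open ≡-Reasoning

sumℤ-triangle : ∀ n (F : ℕ → ℕ → ℤ) →
  sumℤ n (λ s → sumℤ (suc s) (λ i → F i s)) ≡ sumℤ n (λ i → sumℤ (n ∸ i) (λ j → F i (i ℕ.+ j)))
sumℤ-triangle zero    F = refl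
sumℤ-triangle (suc n) F = begin
    sumℤ n (λ s → sumℤ (suc s) (λ i → F i s)) ℤ.+ (sumℤ n (λ i → F i n) ℤ.+ F n n)
  ≡⟨ cong (ℤ._+ (sumℤ n (λ i → F i n) ℤ.+ F n n)) (sumℤ-triangle n F) ⟩
    rows n ℤ.+ (sumℤ n (λ i → F i n) ℤ.+ F n n)
  ≡⟨ sym (ℤP.+-assoc (rows n) (sumℤ n (λ i → F i n)) (F n n)) ⟩
    (rows n ℤ.+ sumℤ n (λ i → F i n)) ℤ.+ F n n
  ≡⟨ cong₂ ℤ._+_ (trans (sym (sumℤ-+ n _ (λ i → F i n))) (sumℤ-cong n extendRow)) lastRow ⟩
    sumℤ n (λ i → sumℤ (suc n ∸ i) (λ j → F i (i ℕ.+ j))) ℤ.+ sumℤ (suc n ∸ n) (λ j → F n (n ℕ.+ j))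
  ∎
  where
  open ≡-Reasoning
  rows : ℕ → ℤ
  rows n = sumℤ n (λ i → sumℤ (n ∸ i) (λ j → F i (i ℕ.+ j)))
  extendRow : ∀ i → i < n →
    sumℤ (n ∸ i) (λ j → F i (i ℕ.+ j)) ℤ.+ F i n ≡ sumℤ (suc n ∸ i) (λ j → F i (i ℕ.+ j))
  extendRow i i<n rewrite ℕP.+-∸-assoc 1 (ℕP.<⇒≤ i<n) =
    cong (λ x → sumℤ (n ∸ i) (λ j → F i (i ℕ.+ j)) ℤ.+ F i x) (sym (ℕP.m+[n∸m]≡n (ℕP.<⇒≤ i<n)))
  lastRow : F n n ≡ sumℤ (suc n ∸ n) (λ j → F n (n ℕ.+ j))
  lastRow rewrite ℕP.+-∸-assoc 1 (ℕP.≤-refl {n}) | ℕP.n∸n≡0 n | ℕP.+-identityʳ n =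
    sym (ℤP.+-identityˡ (F n n))

infix 4 _≈_
record _≈_ (f g : PS) : Set where
  constructor mk≈
  field coeff : ∀ n → f n ≡ g n
open _≈_ public

⊕-isCommutativeMonoid : IsCommutativeMonoid _≈_ _⊕_ 0ₛ
⊕-isCommutativeMonoid = isCommutativeMonoidˡ record
  { isSemigroup = record
    { isMagma = record
      { isEquivalence = record
        { refl  = mk≈ (λ _ → refl)
        ; sym   = λ p → mk≈ (λ n → sym (coeff p n))
        ; trans = λ p q → mk≈ (λ n → trans (coeff p n) (coeff q n)) }
      ; ∙-cong = λ p q → mk≈ (λ n → cong₂ ℤ._+_ (coeff p n) (coeff q n)) }
    ; assoc = λ f g h → mk≈ (λ n → ℤP.+-assoc (f n) (g n) (h n)) }
  ; identityˡ = λ f → mk≈ (λ n → ℤP.+-identityˡ (f n))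
  ; comm      = λ f g → mk≈ (λ n → ℤP.+-comm (f n) (g n)) }

open IsCommutativeMonoid ⊕-isCommutativeMonoid
  using () renaming (refl to ≈-refl; sym to ≈-sym; trans to ≈-trans; reflexive to ≈-reflexive
           ; isEquivalence to ≈-isEquivalence)

⊛-cong : ∀ {f f′ g g′} → f ≈ f′ → g ≈ g′ → (f ⊛ g) ≈ (f′ ⊛ g′)
⊛-cong p q = mk≈ λ n → sumℤ-cong (suc n) (λ i _ → cong₂ ℤ._*_ (coeff p i) (coeff q (n ∸ i)))

⊛-comm : ∀ f g → (f ⊛ g) ≈ (g ⊛ f)
⊛-comm f g = mk≈ λ n → trans (sumℤ-reverse (suc n) _) (sumℤ-cong (suc n) (λ i i≤n →
  trans (cong (λ x → f (n ∸ i) ℤ.* g x) (ℕP.m∸[m∸n]≡n (ℕP.≤-pred i≤n))) (ℤP.*-comm (f (n ∸ i)) (g i))))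

⊛-assoc : ∀ f g h → ((f ⊛ g) ⊛ h) ≈ (f ⊛ (g ⊛ h))
⊛-assoc f g h = mk≈ λ n → begin
    sumℤ (suc n) (λ s → sumℤ (suc s) (λ i → f i ℤ.* g (s ∸ i)) ℤ.* h (n ∸ s))
  ≡⟨ sumℤ-cong (suc n) (λ s _ → sym (sumℤ-*ʳ (suc s) (h (n ∸ s)) (λ i → f i ℤ.* g (s ∸ i)))) ⟩
    sumℤ (suc n) (λ s → sumℤ (suc s) (λ i → F n i s))
  ≡⟨ sumℤ-triangle (suc n) (F n) ⟩
    sumℤ (suc n) (λ i → sumℤ (suc n ∸ i) (λ j → F n i (i ℕ.+ j)))
  ≡⟨ sumℤ-cong (suc n) (inner n) ⟩
    sumℤ (suc n) (λ i → f i ℤ.* sumℤ (suc (n ∸ i)) (λ j → g j ℤ.* h ((n ∸ i) ∸ j)))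
  ∎
  where
  open ≡-Reasoning
  F : ℕ → ℕ → ℕ → ℤ
  F n i s = f i ℤ.* g (s ∸ i) ℤ.* h (n ∸ s)
  inner : ∀ n i → i < suc n → sumℤ (suc n ∸ i) (λ j → F n i (i ℕ.+ j))
                             ≡ f i ℤ.* sumℤ (suc (n ∸ i)) (λ j → g j ℤ.* h ((n ∸ i) ∸ j))
  inner n i i≤n rewrite ℕP.+-∸-assoc 1 (ℕP.≤-pred i≤n) =
    trans (sumℤ-cong (suc (n ∸ i)) (λ j _ →
             trans (cong₂ (λ a b → f i ℤ.* g a ℤ.* h b) (ℕP.m+n∸m≡n i j) (sym (ℕP.∸-+-assoc n i j)))
                   (ℤP.*-assoc (f i) (g j) (h ((n ∸ i) ∸ j)))))
          (sumℤ-*ˡ (suc (n ∸ i)) (f i) (λ j → g j ℤ.* h ((n ∸ i) ∸ j)))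

⊛-identityˡ : ∀ f → (1ₛ ⊛ f) ≈ f
⊛-identityˡ f = mk≈ λ n → begin
    sumℤ (suc n) (λ i → 1ₛ i ℤ.* f (n ∸ i))
  ≡⟨ sumℤ-unfoldˡ n _ ⟩
    + 1 ℤ.* f n ℤ.+ sumℤ n (λ i → + 0 ℤ.* f (n ∸ suc i))
  ≡⟨ cong₂ ℤ._+_ (ℤP.*-identityˡ (f n)) (sumℤ-zero n (λ i _ → ℤP.*-zeroˡ (f (n ∸ suc i)))) ⟩
    f n ℤ.+ + 0
  ≡⟨ ℤP.+-identityʳ (f n) ⟩
    f n
  ∎
  where open ≡-Reasoning

⊛-isCommutativeMonoid : IsCommutativeMonoid _≈_ _⊛_ 1ₛ
⊛-isCommutativeMonoid = isCommutativeMonoidˡ record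
  { isSemigroup = record
    { isMagma = record { isEquivalence = ≈-isEquivalence ; ∙-cong = ⊛-cong }
    ; assoc   = ⊛-assoc }
  ; identityˡ = ⊛-identityˡ
  ; comm      = ⊛-comm }

-- Formal power series in q over ℤ form a commutative semiring.
PS-semiring : CommutativeSemiring 0ℓ 0ℓ
PS-semiring = record
  { isCommutativeSemiring = isCommutativeSemiringʳ record
    { +-isCommutativeMonoid = ⊕-isCommutativeMonoid
    ; *-isCommutativeMonoid = ⊛-isCommutativeMonoid
    ; distribˡ = λ f g h → mk≈ λ n →
        trans (sumℤ-cong (suc n) (λ i _ → ℤP.*-distribˡ-+ (f i) (g (n ∸ i)) (h (n ∸ i))))
              (sumℤ-+ (suc n) _ _)
    ; zeroʳ = λ f → mk≈ λ n → sumℤ-zero (suc n) (λ i _ → ℤP.*-zeroʳ (f i)) } }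

open CommutativeSemiring PS-semiring
  using (setoid)
  renaming ( +-cong to ⊕-cong
           ; +-assoc to ⊕-assoc; +-comm to ⊕-comm
           ; +-identityˡ to ⊕-identityˡ; +-identityʳ to ⊕-identityʳ
           ; *-identityʳ to ⊛-identityʳ
           ; distribˡ to ⊛-distribˡ; distribʳ to ⊛-distribʳ
           ; zeroʳ to ⊛-zeroʳ )

⊛-congˡ : ∀ f {g g′} → g ≈ g′ → (f ⊛ g) ≈ (f ⊛ g′)
⊛-congˡ f = ⊛-cong (≈-refl {f})

⊛-congʳ : ∀ g {f f′} → f ≈ f′ → (f ⊛ g) ≈ (f′ ⊛ g)
⊛-congʳ g p = ⊛-cong p (≈-refl {g})

⊕-congˡ : ∀ f {g g′} → g ≈ g′ → (f ⊕ g) ≈ (f ⊕ g′)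
⊕-congˡ f = ⊕-cong (≈-refl {f})

⊕-congʳ : ∀ g {f f′} → f ≈ f′ → (f ⊕ g) ≈ (f′ ⊕ g)
⊕-congʳ g p = ⊕-cong p (≈-refl {g})

module ⊛ = CommSemigroupProperties (CommutativeSemiring.*-commutativeSemigroup PS-semiring)
module ⊕ = CommSemigroupProperties (CommutativeSemiring.+-commutativeSemigroup PS-semiring)
module ≈-Reasoning = SetoidReasoning setoid

·-cong : ∀ c {f g} → f ≈ g → (c ·ₛ f) ≈ (c ·ₛ g)
·-cong c p = mk≈ λ n → cong (+ c ℤ.*_) (coeff p n)

·-zero : ∀ c → (c ·ₛ 0ₛ) ≈ 0ₛ
·-zero c = mk≈ λ n → ℤP.*-zeroʳ (+ c)

1·ₛ : ∀ f → (1 ·ₛ f) ≈ f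
1·ₛ f = mk≈ λ n → ℤP.*-identityˡ (f n)

·-⊕ : ∀ c f g → (c ·ₛ (f ⊕ g)) ≈ ((c ·ₛ f) ⊕ (c ·ₛ g))
·-⊕ c f g = mk≈ λ n → ℤP.*-distribˡ-+ (+ c) (f n) (g n)

·-* : ∀ a b f → ((a ℕ.* b) ·ₛ f) ≈ (a ·ₛ (b ·ₛ f))
·-* a b f = mk≈ λ n → trans (cong (ℤ._* f n) (ℤP.pos-* a b)) (ℤP.*-assoc (+ a) (+ b) (f n))

·-⊛ : ∀ c f g → (c ·ₛ (f ⊛ g)) ≈ (f ⊛ (c ·ₛ g))
·-⊛ c f g = mk≈ λ n → trans (sym (sumℤ-*ˡ (suc n) (+ c) (λ i → f i ℤ.* g (n ∸ i))))
  (sumℤ-cong (suc n) (λ i _ → trans (sym (ℤP.*-assoc (+ c) (f i) (g (n ∸ i))))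
    (trans (cong (ℤ._* g (n ∸ i)) (ℤP.*-comm (+ c) (f i))) (ℤP.*-assoc (f i) (+ c) (g (n ∸ i))))))

^ₛ-cong : ∀ n {f g} → f ≈ g → (f ^ₛ n) ≈ (g ^ₛ n)
^ₛ-cong zero    p = ≈-refl
^ₛ-cong (suc n) p = ⊛-cong p (^ₛ-cong n p)

^ₛ-+ : ∀ f a b → (f ^ₛ (a ℕ.+ b)) ≈ ((f ^ₛ a) ⊛ (f ^ₛ b))
^ₛ-+ f zero    b = ≈-sym (⊛-identityˡ _)
^ₛ-+ f (suc a) b = ≈-trans (⊛-congˡ f (^ₛ-+ f a b)) (≈-sym (⊛-assoc f (f ^ₛ a) (f ^ₛ b)))

^ₛ-⊛ : ∀ f g n → ((f ⊛ g) ^ₛ n) ≈ ((f ^ₛ n) ⊛ (g ^ₛ n))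
^ₛ-⊛ f g zero    = ≈-sym (⊛-identityˡ 1ₛ)
^ₛ-⊛ f g (suc n) = ≈-trans (⊛-congˡ (f ⊛ g) (^ₛ-⊛ f g n)) (⊛.interchange f g (f ^ₛ n) (g ^ₛ n))

q⊛-zero : ∀ f → (qpow 1 ⊛ f) 0 ≡ + 0
q⊛-zero f = trans (ℤP.+-identityˡ _) (ℤP.*-zeroˡ (f 0))

q⊛-suc : ∀ f n → (qpow 1 ⊛ f) (suc n) ≡ f n
q⊛-suc f n = begin
    sumℤ (suc (suc n)) (λ i → qpow 1 i ℤ.* f (suc n ∸ i))
  ≡⟨ sumℤ-unfoldˡ (suc n) _ ⟩
    + 0 ℤ.* f (suc n) ℤ.+ sumℤ (suc n) (λ i → qpow 1 (suc i) ℤ.* f (n ∸ i))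
  ≡⟨ cong₂ ℤ._+_ (ℤP.*-zeroˡ (f (suc n))) (sumℤ-unfoldˡ n _) ⟩
    + 0 ℤ.+ (+ 1 ℤ.* f n ℤ.+ sumℤ n (λ i → + 0 ℤ.* f (n ∸ suc i)))
  ≡⟨ ℤP.+-identityˡ _ ⟩
    + 1 ℤ.* f n ℤ.+ sumℤ n (λ i → + 0 ℤ.* f (n ∸ suc i))
  ≡⟨ cong₂ ℤ._+_ (ℤP.*-identityˡ (f n)) (sumℤ-zero n (λ i _ → ℤP.*-zeroˡ (f (n ∸ suc i)))) ⟩
    f n ℤ.+ + 0
  ≡⟨ ℤP.+-identityʳ (f n) ⟩
    f n
  ∎
  where open ≡-Reasoning

qpow-zero : qpow 0 ≈ 1ₛ
qpow-zero = mk≈ λ { zero → refl ; (suc n) → refl }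

qpow-suc : ∀ m → qpow (suc m) ≈ (qpow 1 ⊛ qpow m)
qpow-suc m = mk≈ λ { zero → sym (q⊛-zero (qpow m)) ; (suc n) → sym (q⊛-suc (qpow m) n) }

qpow-suc⊛ : ∀ m f → (qpow (suc m) ⊛ f) ≈ (qpow 1 ⊛ (qpow m ⊛ f))
qpow-suc⊛ m f = ≈-trans (⊛-congʳ f (qpow-suc m)) (⊛-assoc (qpow 1) (qpow m) f)

qpow⊛-low : ∀ m f n → n < m → (qpow m ⊛ f) n ≡ + 0
qpow⊛-low (suc m) f zero    _         = trans (coeff (qpow-suc⊛ m f) 0) (q⊛-zero (qpow m ⊛ f))
qpow⊛-low (suc m) f (suc n) (s≤s n<m) =
  trans (coeff (qpow-suc⊛ m f) (suc n)) (trans (q⊛-suc (qpow m ⊛ f) n) (qpow⊛-low m f n n<m))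

qpow⊛-shift : ∀ m f n → (qpow m ⊛ f) (m ℕ.+ n) ≡ f n
qpow⊛-shift zero    f n = coeff (≈-trans (⊛-congʳ f qpow-zero) (⊛-identityˡ f)) n
qpow⊛-shift (suc m) f n =
  trans (coeff (qpow-suc⊛ m f) (suc (m ℕ.+ n))) (trans (q⊛-suc (qpow m ⊛ f) (m ℕ.+ n)) (qpow⊛-shift m f n))

qpow-+ : ∀ a b → qpow (a ℕ.+ b) ≈ (qpow a ⊛ qpow b)
qpow-+ zero    b = ≈-sym (≈-trans (⊛-congʳ (qpow b) qpow-zero) (⊛-identityˡ (qpow b)))
qpow-+ (suc a) b =
  ≈-trans (qpow-suc (a ℕ.+ b)) (≈-trans (⊛-congˡ (qpow 1) (qpow-+ a b)) (≈-sym (qpow-suc⊛ a (qpow b))))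

qpow-^ : ∀ m i → (qpow m ^ₛ i) ≈ qpow (i ℕ.* m)
qpow-^ m zero    = ≈-sym qpow-zero
qpow-^ m (suc i) = ≈-trans (⊛-congˡ (qpow m) (qpow-^ m i)) (≈-sym (qpow-+ m (i ℕ.* m)))

geom-unfold : ∀ m → 1 ≤ m → geom m ≈ (1ₛ ⊕ (qpow m ⊛ geom m))
geom-unfold m 1≤m = mk≈ coeffEq
  where
  indicator : ∀ {b c} → b ≡ c → (if b then + 1 else + 0) ≡ (if c then + 1 else + 0)
  indicator = cong (λ b → if b then + 1 else + 0)
  1ₛ-positive : ∀ n → 1 ≤ n → 1ₛ n ≡ + 0
  1ₛ-positive (suc _) _ = refl
  coeffEq : ∀ n → geom m n ≡ (1ₛ ⊕ (qpow m ⊛ geom m)) n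
  coeffEq n with n ℕ.<? m
  -- below m only the constant term 1 contributes: m ∣ n iff n = 0
  coeffEq zero    | yes _ = trans (indicator (dec-true (m ∣? 0) (m ∣0)))
    (sym (cong (λ x → + 1 ℤ.+ x) (qpow⊛-low m (geom m) 0 1≤m)))
  coeffEq (suc n) | yes n<m = trans (indicator (dec-false (m ∣? suc n) (>⇒∤ n<m)))
    (sym (cong (λ x → + 0 ℤ.+ x) (qpow⊛-low m (geom m) (suc n) n<m)))
  -- from m on, m ∣ m + k iff m ∣ k
  ... | no n≮m = subst (λ x → geom m x ≡ (1ₛ ⊕ (qpow m ⊛ geom m)) x)
                       (ℕP.m+[n∸m]≡n (ℕP.≮⇒≥ n≮m)) (sym (shifted (n ∸ m)))
    where
    shifted : ∀ k → (1ₛ ⊕ (qpow m ⊛ geom m)) (m ℕ.+ k) ≡ geom m (m ℕ.+ k)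
    shifted k = begin
        1ₛ (m ℕ.+ k) ℤ.+ (qpow m ⊛ geom m) (m ℕ.+ k)  ≡⟨ cong₂ ℤ._+_ (1ₛ-positive (m ℕ.+ k) (ℕP.≤-trans 1≤m (ℕP.m≤m+n m k))) (qpow⊛-shift m (geom m) k) ⟩
        + 0 ℤ.+ geom m k                              ≡⟨ ℤP.+-identityˡ _ ⟩
        geom m k                                      ≡⟨ indicator (does-⇔ (mk⇔ (∣m∣n⇒∣m+n ∣-refl) (λ d → ∣m+n∣m⇒∣n d ∣-refl))
                                                                        (m ∣? k) (m ∣? (m ℕ.+ k))) ⟩
        geom m (m ℕ.+ k)                              ∎
      where open ≡-Reasoning

-- Hence 1/[m] = (1-q) + q^m/[m]: this is the identity behind every expansion below.
invBr-unfold : ∀ m → 1 ≤ m → invBr m ≈ ((qpow m ⊛ invBr m) ⊕ oneMinusQ)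
invBr-unfold m 1≤m = begin
    oneMinusQ ⊛ geom m                                  ≈⟨ ⊛-congˡ oneMinusQ (geom-unfold m 1≤m) ⟩
    oneMinusQ ⊛ (1ₛ ⊕ (qpow m ⊛ geom m))                ≈⟨ ⊛-distribˡ oneMinusQ 1ₛ (qpow m ⊛ geom m) ⟩
    (oneMinusQ ⊛ 1ₛ) ⊕ (oneMinusQ ⊛ (qpow m ⊛ geom m))  ≈⟨ ⊕-cong (⊛-identityʳ oneMinusQ) (⊛.x∙yz≈y∙xz oneMinusQ (qpow m) (geom m)) ⟩
    oneMinusQ ⊕ (qpow m ⊛ invBr m)                      ≈⟨ ⊕-comm oneMinusQ (qpow m ⊛ invBr m) ⟩
    (qpow m ⊛ invBr m) ⊕ oneMinusQ                      ∎
  where open ≈-Reasoning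

Σl : {A : Set} → List A → (A → PS) → PS
Σl []       f = 0ₛ
Σl (x ∷ xs) f = f x ⊕ Σl xs f

sumPS-Σl : ∀ (ys : List PS) → sumPS ys ≈ Σl ys (λ y → y)
sumPS-Σl []       = ≈-refl
sumPS-Σl (y ∷ ys) = ⊕-congˡ y (sumPS-Σl ys)

Σl-cong : ∀ {A : Set} (xs : List A) {f g : A → PS} → (∀ x → f x ≈ g x) → Σl xs f ≈ Σl xs g
Σl-cong []       p = ≈-refl
Σl-cong (x ∷ xs) p = ⊕-cong (p x) (Σl-cong xs p)

Σl-congAll : ∀ {A : Set} {xs : List A} {f g : A → PS} → All (λ x → f x ≈ g x) xs → Σl xs f ≈ Σl xs g
Σl-congAll []       = ≈-refl
Σl-congAll (p ∷ ps) = ⊕-cong p (Σl-congAll ps)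

Σl-zero : ∀ {A : Set} (xs : List A) → Σl xs (λ _ → 0ₛ) ≈ 0ₛ
Σl-zero []       = ≈-refl
Σl-zero (x ∷ xs) = ≈-trans (⊕-identityˡ (Σl xs (λ _ → 0ₛ))) (Σl-zero xs)

Σl-⊕ : ∀ {A : Set} (xs : List A) f g → Σl xs (λ x → f x ⊕ g x) ≈ (Σl xs f ⊕ Σl xs g)
Σl-⊕ []       f g = ≈-sym (⊕-identityʳ 0ₛ)
Σl-⊕ (x ∷ xs) f g =
  ≈-trans (⊕-congˡ (f x ⊕ g x) (Σl-⊕ xs f g)) (⊕.interchange (f x) (g x) (Σl xs f) (Σl xs g))

Σl-⊛ : ∀ {A : Set} (xs : List A) h f → (h ⊛ Σl xs f) ≈ Σl xs (λ x → h ⊛ f x)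
Σl-⊛ []       h f = ⊛-zeroʳ h
Σl-⊛ (x ∷ xs) h f = ≈-trans (⊛-distribˡ h (f x) (Σl xs f)) (⊕-congˡ (h ⊛ f x) (Σl-⊛ xs h f))

Σl-⊛-Σl : ∀ {A B : Set} (xs : List A) (ys : List B) f g →
  (Σl xs f ⊛ Σl ys g) ≈ Σl xs (λ x → Σl ys (λ y → f x ⊛ g y))
Σl-⊛-Σl xs ys f g = begin
    Σl xs f ⊛ Σl ys g                          ≈⟨ ⊛-comm (Σl xs f) (Σl ys g) ⟩
    Σl ys g ⊛ Σl xs f                          ≈⟨ Σl-⊛ xs (Σl ys g) f ⟩
    Σl xs (λ x → Σl ys g ⊛ f x)                ≈⟨ Σl-cong xs (λ x → ≈-trans (⊛-comm (Σl ys g) (f x)) (Σl-⊛ ys (f x) g)) ⟩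
    Σl xs (λ x → Σl ys (λ y → f x ⊛ g y))      ∎
  where open ≈-Reasoning

Σl-map : ∀ {A B : Set} (g : A → B) (xs : List A) f → Σl (map g xs) f ≈ Σl xs (f ∘ g)
Σl-map g []       f = ≈-refl
Σl-map g (x ∷ xs) f = ⊕-congˡ (f (g x)) (Σl-map g xs f)

Σl-++ : ∀ {A : Set} (xs ys : List A) f → Σl (xs ++ ys) f ≈ (Σl xs f ⊕ Σl ys f)
Σl-++ []       ys f = ≈-sym (⊕-identityˡ (Σl ys f))
Σl-++ (x ∷ xs) ys f =
  ≈-trans (⊕-congˡ (f x) (Σl-++ xs ys f)) (≈-sym (⊕-assoc (f x) (Σl xs f) (Σl ys f)))

Σl-concatMap : ∀ {A B : Set} (g : A → List B) (xs : List A) f →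
  Σl (concatMap g xs) f ≈ Σl xs (λ x → Σl (g x) f)
Σl-concatMap g []       f = ≈-refl
Σl-concatMap g (x ∷ xs) f =
  ≈-trans (Σl-++ (g x) (concatMap g xs) f) (⊕-congˡ (Σl (g x) f) (Σl-concatMap g xs f))

sumPS-map : ∀ {A : Set} (xs : List A) f → sumPS (map f xs) ≈ Σl xs f
sumPS-map xs f = ≈-trans (sumPS-Σl (map f xs)) (Σl-map f xs (λ y → y))

Σ<-cong : ∀ N {f g : ℕ → PS} → (∀ i → f i ≈ g i) → Σ< N f ≈ Σ< N g
Σ<-cong zero    p = ≈-refl
Σ<-cong (suc N) p = ⊕-cong (Σ<-cong N p) (p N)

Σ<-zero : ∀ N → Σ< N (λ _ → 0ₛ) ≈ 0ₛ
Σ<-zero zero    = ≈-refl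
Σ<-zero (suc N) = ≈-trans (⊕-identityʳ _) (Σ<-zero N)

Σ<-⊕ : ∀ N f g → Σ< N (λ i → f i ⊕ g i) ≈ (Σ< N f ⊕ Σ< N g)
Σ<-⊕ zero    f g = ≈-sym (⊕-identityʳ 0ₛ)
Σ<-⊕ (suc N) f g =
  ≈-trans (⊕-congʳ (f N ⊕ g N) (Σ<-⊕ N f g)) (⊕.interchange (Σ< N f) (Σ< N g) (f N) (g N))

Σ<-⊛ : ∀ N h f → (h ⊛ Σ< N f) ≈ Σ< N (λ i → h ⊛ f i)
Σ<-⊛ zero    h f = ⊛-zeroʳ h
Σ<-⊛ (suc N) h f = ≈-trans (⊛-distribˡ h (Σ< N f) (f N)) (⊕-congʳ (h ⊛ f N) (Σ<-⊛ N h f))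

Σ<-· : ∀ N c f → (c ·ₛ Σ< N f) ≈ Σ< N (λ i → c ·ₛ f i)
Σ<-· zero    c f = ·-zero c
Σ<-· (suc N) c f = ≈-trans (·-⊕ c (Σ< N f) (f N)) (⊕-congʳ (c ·ₛ f N) (Σ<-· N c f))

Σl-Σ< : ∀ {A : Set} (xs : List A) N (F : A → ℕ → PS) →
  Σl xs (λ x → Σ< N (F x)) ≈ Σ< N (λ i → Σl xs (λ x → F x i))
Σl-Σ< []       N F = ≈-sym (Σ<-zero N)
Σl-Σ< (x ∷ xs) N F = ≈-trans (⊕-congˡ (Σ< N (F x)) (Σl-Σ< xs N F))
                             (≈-sym (Σ<-⊕ N (F x) (λ i → Σl xs (λ y → F y i))))

open RawSemiringDefinitions (CommutativeSemiring.rawSemiring PS-semiring)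
  using (_^_; sum) renaming (_×_ to _×ᵣ_)
module Binomial = BinomialTheorem PS-semiring

^ₛ≡^ : ∀ f n → (f ^ₛ n) ≡ (f ^ n)
^ₛ≡^ f zero    = refl
^ₛ≡^ f (suc n) = cong (f ⊛_) (^ₛ≡^ f n)

×ᵣ≈·ₛ : ∀ c f → (c ×ᵣ f) ≈ (c ·ₛ f)
×ᵣ≈·ₛ zero    f = mk≈ λ n → sym (ℤP.*-zeroˡ (f n))
×ᵣ≈·ₛ (suc c) f = mk≈ λ n → trans (cong (λ z → f n ℤ.+ z) (coeff (×ᵣ≈·ₛ c f) n))
  (trans (cong (ℤ._+ (+ c ℤ.* f n)) (sym (ℤP.*-identityˡ (f n)))) (sym (ℤP.*-distribʳ-+ (f n) (+ 1) (+ c))))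

sum≈Σl : ∀ n (h : ℕ → ℕ) (f : Fin n → PS) (g : ℕ → PS) → (∀ k → f k ≈ g (h (toℕ k))) →
         sum f ≈ Σl (applyUpTo h n) g
sum≈Σl zero    h f g p = ≈-refl
sum≈Σl (suc n) h f g p = ⊕-cong (p fzero) (sum≈Σl n (h ∘ suc) (f ∘ fsuc) g (λ k → p (fsuc k)))

binomial : ∀ n x y → ((x ⊕ y) ^ₛ n) ≈ Σl (upTo (suc n)) (λ i → (n C i) ·ₛ ((x ^ₛ i) ⊛ (y ^ₛ (n ∸ i))))
binomial n x y = begin
    (x ⊕ y) ^ₛ n                   ≡⟨ ^ₛ≡^ (x ⊕ y) n ⟩
    (x ⊕ y) ^ n                    ≈⟨ Binomial.theorem n x y ⟩
    Binomial.binomialExpansion x y n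
      ≈⟨ sum≈Σl (suc n) (λ i → i) _ (λ i → (n C i) ·ₛ ((x ^ₛ i) ⊛ (y ^ₛ (n ∸ i)))) (λ k → ≈-trans (×ᵣ≈·ₛ (n C toℕ k) _)
            (≈-reflexive (cong₂ (λ u v → (n C toℕ k) ·ₛ (u ⊛ v)) (sym (^ₛ≡^ x (toℕ k))) (sym (^ₛ≡^ y (n ∸ toℕ k)))))) ⟩
    Σl (upTo (suc n)) (λ i → (n C i) ·ₛ ((x ^ₛ i) ⊛ (y ^ₛ (n ∸ i))))  ∎
  where open ≈-Reasoning

binomial-weighted : ∀ P x y k (W : ℕ → PS) → (∀ i → (P ⊛ (x ^ₛ i)) ≈ W i) →
  (P ⊛ ((x ⊕ y) ^ₛ k)) ≈ Σl (upTo (suc k)) (λ i → (k C i) ·ₛ ((y ^ₛ (k ∸ i)) ⊛ W i))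
binomial-weighted P x y k W PxW = begin
    P ⊛ ((x ⊕ y) ^ₛ k)
  ≈⟨ ⊛-congˡ P (binomial k x y) ⟩
    P ⊛ Σl (upTo (suc k)) (λ i → (k C i) ·ₛ ((x ^ₛ i) ⊛ (y ^ₛ (k ∸ i))))
  ≈⟨ Σl-⊛ (upTo (suc k)) P (λ i → (k C i) ·ₛ ((x ^ₛ i) ⊛ (y ^ₛ (k ∸ i)))) ⟩
    Σl (upTo (suc k)) (λ i → P ⊛ ((k C i) ·ₛ ((x ^ₛ i) ⊛ (y ^ₛ (k ∸ i)))))
  ≈⟨ Σl-cong (upTo (suc k)) term ⟩
    Σl (upTo (suc k)) (λ i → (k C i) ·ₛ ((y ^ₛ (k ∸ i)) ⊛ W i))
  ∎
  where
  open ≈-Reasoning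
  term : ∀ i → (P ⊛ ((k C i) ·ₛ ((x ^ₛ i) ⊛ (y ^ₛ (k ∸ i))))) ≈ ((k C i) ·ₛ ((y ^ₛ (k ∸ i)) ⊛ W i))
  term i = ≈-trans (≈-sym (·-⊛ (k C i) P ((x ^ₛ i) ⊛ (y ^ₛ (k ∸ i)))))
    (·-cong (k C i) (≈-trans (⊛.x∙yz≈z∙xy P (x ^ₛ i) (y ^ₛ (k ∸ i))) (⊛-congˡ (y ^ₛ (k ∸ i)) (PxW i))))

-- Identities between the summand weights at a fixed summation variable m ≥ 1.
-- Writing B = 1/[m], they all come from B = q^m B + (1-q) (invBr-unfold).
module _ (m : ℕ) (1≤m : 1 ≤ m) where
  private
    B = invBr m
    x = qpow m ⊛ B
    y = oneMinusQ

    x^ : ∀ i → (x ^ₛ i) ≈ (qpow (i ℕ.* m) ⊛ (B ^ₛ i))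
    x^ i = ≈-trans (^ₛ-⊛ (qpow m) B i) (⊛-congʳ (B ^ₛ i) (qpow-^ m i))

  wLi-expand : ∀ k →
    wLi (suc k) m ≈ Σl (upTo (suc k)) (λ i → (k C i) ·ₛ ((oneMinusQ ^ₛ (k ∸ i)) ⊛ wZ (suc i) m))
  wLi-expand k =
    ≈-trans (⊛-congˡ B (^ₛ-cong k (invBr-unfold m 1≤m))) (binomial-weighted B x y k (λ i → wZ (suc i) m) Bx^)
    where
    Bx^ : ∀ i → (B ⊛ (x ^ₛ i)) ≈ wZ (suc i) m
    Bx^ i = ≈-trans (⊛-congˡ B (x^ i)) (⊛.x∙yz≈y∙xz B (qpow (i ℕ.* m)) (B ^ₛ i))

  -- q^m/[m]^{k+2} = Σ_{i≤k} C(k,i) (1-q)^{k-i} q^{(i+1)m}/[m]^{i+2}: the same for the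
  -- outermost variable of Li(q), which carries the extra factor q^m and exponent k₁ ≥ 2.
  q-wLi-expand : ∀ k →
    (qpow m ⊛ wLi (2 ℕ.+ k) m) ≈ Σl (upTo (suc k)) (λ i → (k C i) ·ₛ ((oneMinusQ ^ₛ (k ∸ i)) ⊛ wZ (2 ℕ.+ i) m))
  q-wLi-expand k = begin
      qpow m ⊛ (B ⊛ (B ⊛ (B ^ₛ k)))
    ≈⟨ ⊛-congˡ (qpow m) (≈-sym (⊛-assoc B B (B ^ₛ k))) ⟩
      qpow m ⊛ ((B ⊛ B) ⊛ (B ^ₛ k))
    ≈⟨ ≈-sym (⊛-assoc (qpow m) (B ⊛ B) (B ^ₛ k)) ⟩
      P ⊛ (B ^ₛ k)
    ≈⟨ ⊛-congˡ P (^ₛ-cong k (invBr-unfold m 1≤m)) ⟩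
      P ⊛ ((x ⊕ y) ^ₛ k)
    ≈⟨ binomial-weighted P x y k (λ i → wZ (2 ℕ.+ i) m) Px^ ⟩
      Σl (upTo (suc k)) (λ i → (k C i) ·ₛ ((oneMinusQ ^ₛ (k ∸ i)) ⊛ wZ (2 ℕ.+ i) m))
    ∎
    where
    open ≈-Reasoning
    P = qpow m ⊛ (B ⊛ B)
    Px^ : ∀ i → (P ⊛ (x ^ₛ i)) ≈ wZ (2 ℕ.+ i) m
    Px^ i = ≈-trans (⊛-congˡ P (x^ i))
      (≈-trans (⊛.interchange (qpow m) (B ⊛ B) (qpow (i ℕ.* m)) (B ^ₛ i))
               (⊛-cong (≈-sym (qpow-+ m (i ℕ.* m))) (⊛-assoc B B (B ^ₛ i))))

  -- The product of two ζ-weights at the same variable: this produces the "+" and "-1+"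
  -- fillings, q^{am}/[m]^{a+1} · q^{bm}/[m]^{b+1}
  --   = q^{(a+b+1)m}/[m]^{a+b+2} + (1-q) q^{(a+b)m}/[m]^{a+b+1}.
  wZ-merge : ∀ a b →
    (wZ (suc a) m ⊛ wZ (suc b) m) ≈ (wZ (2 ℕ.+ (a ℕ.+ b)) m ⊕ (oneMinusQ ⊛ wZ (suc (a ℕ.+ b)) m))
  wZ-merge a b = begin
      (qpow (a ℕ.* m) ⊛ (B ^ₛ suc a)) ⊛ (qpow (b ℕ.* m) ⊛ (B ^ₛ suc b))
    ≈⟨ ⊛.interchange (qpow (a ℕ.* m)) (B ^ₛ suc a) (qpow (b ℕ.* m)) (B ^ₛ suc b) ⟩
      (qpow (a ℕ.* m) ⊛ qpow (b ℕ.* m)) ⊛ ((B ^ₛ suc a) ⊛ (B ^ₛ suc b))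
    ≈⟨ ⊛-cong qpows Bpows ⟩
      R ⊛ ((x ⊕ y) ⊛ (B ^ₛ suc n))
    ≈⟨ ⊛-congˡ R (⊛-distribʳ (B ^ₛ suc n) x y) ⟩
      R ⊛ ((x ⊛ (B ^ₛ suc n)) ⊕ (y ⊛ (B ^ₛ suc n)))
    ≈⟨ ⊛-distribˡ R (x ⊛ (B ^ₛ suc n)) (y ⊛ (B ^ₛ suc n)) ⟩
      (R ⊛ (x ⊛ (B ^ₛ suc n))) ⊕ (R ⊛ (y ⊛ (B ^ₛ suc n)))
    ≈⟨ ⊕-cong first (⊛.x∙yz≈y∙xz R y (B ^ₛ suc n)) ⟩
      wZ (2 ℕ.+ n) m ⊕ (oneMinusQ ⊛ wZ (suc n) m)
    ∎
    where
    open ≈-Reasoning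
    n = a ℕ.+ b
    R = qpow (n ℕ.* m)
    qpows : (qpow (a ℕ.* m) ⊛ qpow (b ℕ.* m)) ≈ R
    qpows = ≈-trans (≈-sym (qpow-+ (a ℕ.* m) (b ℕ.* m))) (≈-reflexive (cong qpow (sym (ℕP.*-distribʳ-+ m a b))))
    Bpows : ((B ^ₛ suc a) ⊛ (B ^ₛ suc b)) ≈ ((x ⊕ y) ⊛ (B ^ₛ suc n))
    Bpows = ≈-trans (≈-sym (^ₛ-+ B (suc a) (suc b)))
      (≈-trans (≈-reflexive (cong (λ e → B ^ₛ suc e) (ℕP.+-suc a b)))
               (⊛-congʳ (B ^ₛ suc n) (invBr-unfold m 1≤m)))
    first : (R ⊛ (x ⊛ (B ^ₛ suc n))) ≈ wZ (2 ℕ.+ n) m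
    first = begin
        R ⊛ ((qpow m ⊛ B) ⊛ (B ^ₛ suc n))  ≈⟨ ⊛-congˡ R (⊛-assoc (qpow m) B (B ^ₛ suc n)) ⟩
        R ⊛ (qpow m ⊛ (B ^ₛ (2 ℕ.+ n)))    ≈⟨ ⊛.x∙yz≈yx∙z R (qpow m) (B ^ₛ (2 ℕ.+ n)) ⟩
        (qpow m ⊛ R) ⊛ (B ^ₛ (2 ℕ.+ n))    ≈⟨ ⊛-congʳ (B ^ₛ (2 ℕ.+ n)) (≈-sym (qpow-+ m (n ℕ.* m))) ⟩
        wZ (2 ℕ.+ n) m                     ∎

-- Power series in t are handled coefficientwise (d ↦ coefficient of t^d):
-- "when b X" extracts a term t^e X at t^d (b is e ≡ᵇ d), tShift F is t·F, tOne is 1.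

when : Bool → PS → PS
when b X = if b then X else 0ₛ

when-cong : ∀ b {X Y} → X ≈ Y → when b X ≈ when b Y
when-cong true  p = p
when-cong false p = ≈-refl

when-⊛ : ∀ b h X → when b (h ⊛ X) ≈ (h ⊛ when b X)
when-⊛ true  h X = ≈-refl
when-⊛ false h X = ≈-sym (⊛-zeroʳ h)

when-⊕ : ∀ b X Y → (when b X ⊕ when b Y) ≈ when b (X ⊕ Y)
when-⊕ true  X Y = ≈-refl
when-⊕ false X Y = ⊕-identityʳ 0ₛ

when-Σ< : ∀ b N F → when b (Σ< N F) ≈ Σ< N (λ i → when b (F i))
when-Σ< true  N F = ≈-refl
when-Σ< false N F = ≈-sym (Σ<-zero N)

tShift : (ℕ → PS) → ℕ → PS
tShift F zero    = 0ₛ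
tShift F (suc d) = F d

tOne : ℕ → PS
tOne zero    = 1ₛ
tOne (suc _) = 0ₛ

tShift-cong : ∀ {F G : ℕ → PS} d → (∀ d′ → F d′ ≈ G d′) → tShift F d ≈ tShift G d
tShift-cong zero    p = ≈-refl
tShift-cong (suc d) p = p d

when-tShift : ∀ e d W Y → when (suc e ≡ᵇ d) (W ⊛ Y) ≈ (W ⊛ tShift (λ d′ → when (e ≡ᵇ d′) Y) d)
when-tShift e zero    W Y = ≈-sym (⊛-zeroʳ W)
when-tShift e (suc d) W Y = when-⊛ (e ≡ᵇ d) W Y

Σl-tShift : ∀ {A : Set} (xs : List A) (F : A → ℕ → PS) d →
  Σl xs (λ x → tShift (F x) d) ≈ tShift (λ d′ → Σl xs (λ x → F x d′)) d
Σl-tShift xs F zero    = Σl-zero xs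
Σl-tShift xs F (suc d) = ≈-refl

Σl-split : ∀ {A : Set} (xs : List A) (F G : A → ℕ → PS) N d →
  Σl xs (λ x → Σ< N (F x) ⊕ tShift (G x) d)
    ≈ (Σ< N (λ j → Σl xs (λ x → F x j)) ⊕ tShift (λ d′ → Σl xs (λ x → G x d′)) d)
Σl-split xs F G N d =
  ≈-trans (Σl-⊕ xs (λ x → Σ< N (F x)) (λ x → tShift (G x) d)) (⊕-cong (Σl-Σ< xs N F) (Σl-tShift xs G d))

outer : (ℕ → ℕ → PS) → List ℕ → ℕ → PS
outer w []       m = 0ₛ
outer w (p ∷ ps) m = w p m ⊛ chain w ps m

-- Coefficient of t^d in the part of Li^t_{(k,ks)} (without the factor q^{m₁}) resp. ζ^t_{(k,ks)}
-- whose outermost summation variable equals m.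
LiAt : ℕ → List ℕ → ℕ → ℕ → PS
LiAt k ks m d = Σl (fillLi k ks) (λ p → when ((length (k ∷ ks) ∸ length p) ≡ᵇ d) (outer wLi p m))

ζAt : ℕ → List ℕ → ℕ → ℕ → PS
ζAt k ks m d = Σl (fillZ k ks) (λ p → when ((length (k ∷ ks) ∸ length p) ≡ᵇ d)
                                            ((oneMinusQ ^ₛ (wt (k ∷ ks) ∸ wt p)) ⊛ outer wZ p m))

-- What sits below an entry whose variable is m: the fillings of ks either start with a
-- "," (outermost variable < m) or with a "+" (resp. "+"/"-1+"), which uses the variable m
-- again and costs one power of t.
LiBelow : List ℕ → ℕ → ℕ → PS
LiBelow []       m d = tOne d
LiBelow (k ∷ ks) m d = Σ< (m ∸ 1) (λ i → LiAt k ks (suc i) d) ⊕ tShift (LiAt k ks m) d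

ζBelow : List ℕ → ℕ → ℕ → PS
ζBelow []       m d = tOne d
ζBelow (k ∷ ks) m d = Σ< (m ∸ 1) (λ i → ζAt k ks (suc i) d) ⊕ tShift (ζAt k ks m) d

All-concatMap : ∀ {A B : Set} {P : A → Set} {Q : B → Set} (g : A → List B) {xs : List A} →
  (∀ x → P x → All Q (g x)) → All P xs → All Q (concatMap g xs)
All-concatMap g h pxs = concat⁺ (map⁺ (All.map (λ {x} → h x) pxs))

LiShape : ℕ → List ℕ → Set
LiShape L []       = ⊥
LiShape L (p ∷ ps) = length ps ≤ L

fillLi-shape : ∀ k ks → All (LiShape (length ks)) (fillLi k ks)
fillLi-shape k []        = z≤n ∷ []
fillLi-shape k (k′ ∷ ks) = All-concatMap (extLi k) ext (fillLi-shape k′ ks)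
  where
  ext : ∀ h → LiShape (length ks) h → All (LiShape (suc (length ks))) (extLi k h)
  ext (p ∷ ps) ℓ≤ = s≤s ℓ≤ ∷ ℕP.m≤n⇒m≤1+n ℓ≤ ∷ []

ζShape : ℕ → ℕ → ℕ → List ℕ → Set
ζShape c L W []       = ⊥
ζShape c L W (p ∷ ps) = c ≤ p × length ps ≤ L × p ℕ.+ wt ps ≤ W

fillZ-shape : ∀ k ks → 1 ≤ k → All (1 ≤_) ks → All (ζShape k (length ks) (wt (k ∷ ks))) (fillZ k ks)
fillZ-shape k []        _   _               = (ℕP.≤-refl , z≤n , ℕP.≤-refl) ∷ []
fillZ-shape k (k′ ∷ ks) 1≤k (1≤k′ ∷ 1≤ks) = All-concatMap (extZ k) ext (fillZ-shape k′ ks 1≤k′ 1≤ks)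
  where
  W′ = wt (k′ ∷ ks)
  ext : ∀ h → ζShape k′ (length ks) W′ h → All (ζShape k (suc (length ks)) (k ℕ.+ W′)) (extZ k h)
  ext (p ∷ ps) (k′≤p , ℓ≤ , w≤) =
      (ℕP.≤-refl , s≤s ℓ≤ , ℕP.+-monoʳ-≤ k w≤)
    ∷ (ℕP.m≤m+n k p , ℕP.m≤n⇒m≤1+n ℓ≤ , joined≤)
    ∷ (k≤k+p-1 , ℕP.m≤n⇒m≤1+n ℓ≤ , ℕP.≤-trans (ℕP.+-monoˡ-≤ (wt ps) (ℕP.m∸n≤m (k ℕ.+ p) 1)) joined≤)
    ∷ []
    where
    joined≤ : k ℕ.+ p ℕ.+ wt ps ≤ k ℕ.+ W′
    joined≤ = subst (_≤ k ℕ.+ W′) (sym (ℕP.+-assoc k p (wt ps))) (ℕP.+-monoʳ-≤ k w≤)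
    k≤k+p-1 : k ≤ k ℕ.+ p ∸ 1
    k≤k+p-1 = subst (k ≤_) (sym (ℕP.+-∸-assoc k (ℕP.≤-trans 1≤k′ k′≤p))) (ℕP.m≤m+n k (p ∸ 1))

-- Each filling h of ks contributes through its extensions
-- k,h  and  k+h₁,h₂,…  (and k+h₁-1,h₂,…  for ζ); the first gives the ","-part of the
-- inner sum, the others the t-shifted "+"-part.

factor-below : ∀ {A : Set} (xs : List A) W N (a b : A → ℕ → PS) d →
  Σl xs (λ h → W ⊛ (Σ< N (a h) ⊕ tShift (b h) d))
    ≈ (W ⊛ (Σ< N (λ i → Σl xs (λ h → a h i)) ⊕ tShift (λ d′ → Σl xs (λ h → b h d′)) d))
factor-below xs W N a b d =
  ≈-trans (≈-sym (Σl-⊛ xs W (λ h → Σ< N (a h) ⊕ tShift (b h) d))) (⊛-congˡ W (Σl-split xs a b N d))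

LiAt-extensions : ∀ k L m d h → LiShape L h →
  Σl (extLi k h) (λ p → when ((suc (suc L) ∸ length p) ≡ᵇ d) (outer wLi p m))
    ≈ (wLi k m ⊛ (Σ< (m ∸ 1) (λ i → when ((suc L ∸ length h) ≡ᵇ d) (outer wLi h (suc i)))
                   ⊕ tShift (λ d′ → when ((suc L ∸ length h) ≡ᵇ d′) (outer wLi h m)) d))
LiAt-extensions k L m d (p ∷ ps) ℓ≤L = begin
    when (e ≡ᵇ d) (W ⊛ chain wLi (p ∷ ps) m) ⊕ (when ((suc L ∸ length ps) ≡ᵇ d) (wLi (k ℕ.+ p) m ⊛ I) ⊕ 0ₛ)
  ≈⟨ ⊕-cong comma (≈-trans (⊕-identityʳ _) join) ⟩
    (W ⊛ Σ< (m ∸ 1) (λ i → when (e ≡ᵇ d) (outer wLi (p ∷ ps) (suc i))))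
      ⊕ (W ⊛ tShift (λ d′ → when (e ≡ᵇ d′) (outer wLi (p ∷ ps) m)) d)
  ≈⟨ ≈-sym (⊛-distribˡ W (Σ< (m ∸ 1) (λ i → when (e ≡ᵇ d) (outer wLi (p ∷ ps) (suc i))))
                          (tShift (λ d′ → when (e ≡ᵇ d′) (outer wLi (p ∷ ps) m)) d)) ⟩
    W ⊛ (Σ< (m ∸ 1) (λ i → when (e ≡ᵇ d) (outer wLi (p ∷ ps) (suc i)))
           ⊕ tShift (λ d′ → when (e ≡ᵇ d′) (outer wLi (p ∷ ps) m)) d)
  ∎
  where
  open ≈-Reasoning
  W = wLi k m
  I = chain wLi ps m
  e = L ∸ length ps
  comma : when (e ≡ᵇ d) (W ⊛ chain wLi (p ∷ ps) m)
        ≈ (W ⊛ Σ< (m ∸ 1) (λ i → when (e ≡ᵇ d) (outer wLi (p ∷ ps) (suc i))))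
  comma = ≈-trans (when-⊛ (e ≡ᵇ d) W (chain wLi (p ∷ ps) m))
                  (⊛-congˡ W (when-Σ< (e ≡ᵇ d) (m ∸ 1) (λ i → outer wLi (p ∷ ps) (suc i))))
  -- 1/[m]^{k+p} = 1/[m]^k · 1/[m]^p, and the merge raises the t-degree by one
  join : when ((suc L ∸ length ps) ≡ᵇ d) (wLi (k ℕ.+ p) m ⊛ I)
       ≈ (W ⊛ tShift (λ d′ → when (e ≡ᵇ d′) (outer wLi (p ∷ ps) m)) d)
  join = begin
      when ((suc L ∸ length ps) ≡ᵇ d) (wLi (k ℕ.+ p) m ⊛ I)
    ≡⟨ cong (λ z → when (z ≡ᵇ d) (wLi (k ℕ.+ p) m ⊛ I)) (ℕP.+-∸-assoc 1 ℓ≤L) ⟩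
      when (suc e ≡ᵇ d) (wLi (k ℕ.+ p) m ⊛ I)
    ≈⟨ when-cong (suc e ≡ᵇ d) (≈-trans (⊛-congʳ I (^ₛ-+ (invBr m) k p)) (⊛-assoc W (wLi p m) I)) ⟩
      when (suc e ≡ᵇ d) (W ⊛ outer wLi (p ∷ ps) m)
    ≈⟨ when-tShift e d W (outer wLi (p ∷ ps) m) ⟩
      W ⊛ tShift (λ d′ → when (e ≡ᵇ d′) (outer wLi (p ∷ ps) m)) d
    ∎

LiAt-unfold : ∀ k ks m d → LiAt k ks m d ≈ (wLi k m ⊛ LiBelow ks m d)
LiAt-unfold k []        m zero    = ⊕-identityʳ _
LiAt-unfold k []        m (suc d) = ≈-trans (⊕-identityʳ 0ₛ) (≈-sym (⊛-zeroʳ (wLi k m)))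
LiAt-unfold k (k′ ∷ ks) m d = begin
    LiAt k (k′ ∷ ks) m d
  ≈⟨ Σl-concatMap (extLi k) (fillLi k′ ks) T ⟩
    Σl (fillLi k′ ks) (λ h → Σl (extLi k h) T)
  ≈⟨ Σl-congAll (All.map (λ {h} → LiAt-extensions k (length ks) m d h) (fillLi-shape k′ ks)) ⟩
    Σl (fillLi k′ ks) (λ h → wLi k m ⊛ (Σ< (m ∸ 1) (a h) ⊕ tShift (b h) d))
  ≈⟨ factor-below (fillLi k′ ks) (wLi k m) (m ∸ 1) a b d ⟩
    wLi k m ⊛ LiBelow (k′ ∷ ks) m d
  ∎
  where
  open ≈-Reasoning
  T : List ℕ → PS
  T p = when ((length (k ∷ k′ ∷ ks) ∸ length p) ≡ᵇ d) (outer wLi p m)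
  a : List ℕ → ℕ → PS
  a h i = when ((length (k′ ∷ ks) ∸ length h) ≡ᵇ d) (outer wLi h (suc i))
  b : List ℕ → ℕ → PS
  b h d′ = when ((length (k′ ∷ ks) ∸ length h) ≡ᵇ d′) (outer wLi h m)

∸-suc : ∀ m n → n < m → m ∸ n ≡ suc (m ∸ suc n)
∸-suc (suc m) zero    _         = refl
∸-suc (suc m) (suc n) (s≤s n<m) = ∸-suc m n n<m

weight-gap-+ : ∀ k W p x → (k ℕ.+ W) ∸ ((k ℕ.+ p) ℕ.+ x) ≡ W ∸ (p ℕ.+ x)
weight-gap-+ k W p x = trans (cong ((k ℕ.+ W) ∸_) (ℕP.+-assoc k p x)) (ℕP.[m+n]∸[m+o]≡n∸o k W (p ℕ.+ x))

weight-gap-+-1 : ∀ k b W x → suc b ℕ.+ x ≤ W → (k ℕ.+ W) ∸ ((k ℕ.+ suc b ∸ 1) ℕ.+ x) ≡ suc (W ∸ (suc b ℕ.+ x))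
weight-gap-+-1 k b W x w≤ = begin
    (k ℕ.+ W) ∸ ((k ℕ.+ suc b ∸ 1) ℕ.+ x)  ≡⟨ cong (λ z → (k ℕ.+ W) ∸ ((z ∸ 1) ℕ.+ x)) (ℕP.+-suc k b) ⟩
    (k ℕ.+ W) ∸ ((k ℕ.+ b) ℕ.+ x)          ≡⟨ weight-gap-+ k W b x ⟩
    W ∸ (b ℕ.+ x)                          ≡⟨ ∸-suc W (b ℕ.+ x) w≤ ⟩
    suc (W ∸ (suc b ℕ.+ x))                ∎
  where open ≡-Reasoning

merge-extensions : ∀ m → 1 ≤ m → ∀ a b E I →
  (((oneMinusQ ^ₛ E) ⊛ (wZ (suc a ℕ.+ suc b) m ⊛ I)) ⊕ ((oneMinusQ ^ₛ suc E) ⊛ (wZ (suc a ℕ.+ suc b ∸ 1) m ⊛ I)))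
    ≈ (wZ (suc a) m ⊛ ((oneMinusQ ^ₛ E) ⊛ (wZ (suc b) m ⊛ I)))
merge-extensions m 1≤m a b E I = begin
    (O ⊛ (Z₂ ⊛ I)) ⊕ ((oneMinusQ ⊛ O) ⊛ (Z₁ ⊛ I))
  ≈⟨ ⊕-congˡ (O ⊛ (Z₂ ⊛ I)) (≈-trans (⊛-assoc oneMinusQ O (Z₁ ⊛ I)) (⊛.x∙yz≈y∙xz oneMinusQ O (Z₁ ⊛ I))) ⟩
    (O ⊛ (Z₂ ⊛ I)) ⊕ (O ⊛ (oneMinusQ ⊛ (Z₁ ⊛ I)))
  ≈⟨ ≈-sym (⊛-distribˡ O (Z₂ ⊛ I) (oneMinusQ ⊛ (Z₁ ⊛ I))) ⟩
    O ⊛ ((Z₂ ⊛ I) ⊕ (oneMinusQ ⊛ (Z₁ ⊛ I)))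
  ≈⟨ ⊛-congˡ O (⊕-congˡ (Z₂ ⊛ I) (≈-sym (⊛-assoc oneMinusQ Z₁ I))) ⟩
    O ⊛ ((Z₂ ⊛ I) ⊕ ((oneMinusQ ⊛ Z₁) ⊛ I))
  ≈⟨ ⊛-congˡ O (≈-sym (⊛-distribʳ I Z₂ (oneMinusQ ⊛ Z₁))) ⟩
    O ⊛ ((Z₂ ⊕ (oneMinusQ ⊛ Z₁)) ⊛ I)
  ≈⟨ ⊛-congˡ O (⊛-congʳ I (≈-sym merged)) ⟩
    O ⊛ ((wZ (suc a) m ⊛ wZ (suc b) m) ⊛ I)
  ≈⟨ ⊛-congˡ O (⊛-assoc (wZ (suc a) m) (wZ (suc b) m) I) ⟩
    O ⊛ (wZ (suc a) m ⊛ (wZ (suc b) m ⊛ I))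
  ≈⟨ ⊛.x∙yz≈y∙xz O (wZ (suc a) m) (wZ (suc b) m ⊛ I) ⟩
    wZ (suc a) m ⊛ (O ⊛ (wZ (suc b) m ⊛ I))
  ∎
  where
  open ≈-Reasoning
  O  = oneMinusQ ^ₛ E
  Z₂ = wZ (suc a ℕ.+ suc b) m
  Z₁ = wZ (suc a ℕ.+ suc b ∸ 1) m
  -- suc a + suc b = 2 + (a + b) up to +-suc
  merged : (wZ (suc a) m ⊛ wZ (suc b) m) ≈ (Z₂ ⊕ (oneMinusQ ⊛ Z₁))
  merged = subst (λ n → (wZ (suc a) m ⊛ wZ (suc b) m) ≈ (wZ (suc n) m ⊕ (oneMinusQ ⊛ wZ n m)))
                 (sym (ℕP.+-suc a b)) (wZ-merge m 1≤m a b)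

ζAt-extensions : ∀ a L W m d b ps → 1 ≤ m → length ps ≤ L → suc b ℕ.+ wt ps ≤ W →
  let e = L ∸ length ps
      O = oneMinusQ ^ₛ (W ∸ (suc b ℕ.+ wt ps)) in
  Σl (extZ (suc a) (suc b ∷ ps))
     (λ p → when ((suc (suc L) ∸ length p) ≡ᵇ d) ((oneMinusQ ^ₛ ((suc a ℕ.+ W) ∸ wt p)) ⊛ outer wZ p m))
    ≈ (wZ (suc a) m ⊛ (Σ< (m ∸ 1) (λ i → when (e ≡ᵇ d) (O ⊛ outer wZ (suc b ∷ ps) (suc i)))
                        ⊕ tShift (λ d′ → when (e ≡ᵇ d′) (O ⊛ outer wZ (suc b ∷ ps) m)) d))
ζAt-extensions a L W m d b ps 1≤m ℓ≤L w≤W = begin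
    T₀ ⊕ (T₊ ⊕ (T₋ ⊕ 0ₛ))
  ≈⟨ ⊕-cong comma (≈-trans (⊕-congˡ T₊ (⊕-identityʳ T₋)) join) ⟩
    (W₁ ⊛ Σ< (m ∸ 1) (λ i → when (e ≡ᵇ d) (O ⊛ outer wZ h (suc i))))
      ⊕ (W₁ ⊛ tShift (λ d′ → when (e ≡ᵇ d′) (O ⊛ outer wZ h m)) d)
  ≈⟨ ≈-sym (⊛-distribˡ W₁ (Σ< (m ∸ 1) (λ i → when (e ≡ᵇ d) (O ⊛ outer wZ h (suc i))))
                           (tShift (λ d′ → when (e ≡ᵇ d′) (O ⊛ outer wZ h m)) d)) ⟩
    W₁ ⊛ (Σ< (m ∸ 1) (λ i → when (e ≡ᵇ d) (O ⊛ outer wZ h (suc i)))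
            ⊕ tShift (λ d′ → when (e ≡ᵇ d′) (O ⊛ outer wZ h m)) d)
  ∎
  where
  open ≈-Reasoning
  k  = suc a
  p  = suc b
  h  = p ∷ ps
  W₁ = wZ k m
  I  = chain wZ ps m
  e  = L ∸ length ps
  E  = W ∸ (p ℕ.+ wt ps)
  O  = oneMinusQ ^ₛ E
  b₊ = (suc L ∸ length ps) ≡ᵇ d
  T₀ T₊ T₋ : PS
  T₀ = when (e ≡ᵇ d) ((oneMinusQ ^ₛ ((k ℕ.+ W) ∸ (k ℕ.+ (p ℕ.+ wt ps)))) ⊛ (W₁ ⊛ chain wZ h m))
  T₊ = when b₊ ((oneMinusQ ^ₛ ((k ℕ.+ W) ∸ ((k ℕ.+ p) ℕ.+ wt ps))) ⊛ (wZ (k ℕ.+ p) m ⊛ I))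
  T₋ = when b₊ ((oneMinusQ ^ₛ ((k ℕ.+ W) ∸ ((k ℕ.+ p ∸ 1) ℕ.+ wt ps))) ⊛ (wZ (k ℕ.+ p ∸ 1) m ⊛ I))
  comma : T₀ ≈ (W₁ ⊛ Σ< (m ∸ 1) (λ i → when (e ≡ᵇ d) (O ⊛ outer wZ h (suc i))))
  comma = begin
      T₀
    ≡⟨ cong (λ z → when (e ≡ᵇ d) ((oneMinusQ ^ₛ z) ⊛ (W₁ ⊛ chain wZ h m))) (ℕP.[m+n]∸[m+o]≡n∸o k W (p ℕ.+ wt ps)) ⟩
      when (e ≡ᵇ d) (O ⊛ (W₁ ⊛ chain wZ h m))
    ≈⟨ when-cong (e ≡ᵇ d) (⊛.x∙yz≈y∙xz O W₁ (chain wZ h m)) ⟩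
      when (e ≡ᵇ d) (W₁ ⊛ (O ⊛ chain wZ h m))
    ≈⟨ when-⊛ (e ≡ᵇ d) W₁ (O ⊛ chain wZ h m) ⟩
      W₁ ⊛ when (e ≡ᵇ d) (O ⊛ Σ< (m ∸ 1) (λ i → outer wZ h (suc i)))
    ≈⟨ ⊛-congˡ W₁ (when-cong (e ≡ᵇ d) (Σ<-⊛ (m ∸ 1) O (λ i → outer wZ h (suc i)))) ⟩
      W₁ ⊛ when (e ≡ᵇ d) (Σ< (m ∸ 1) (λ i → O ⊛ outer wZ h (suc i)))
    ≈⟨ ⊛-congˡ W₁ (when-Σ< (e ≡ᵇ d) (m ∸ 1) (λ i → O ⊛ outer wZ h (suc i))) ⟩
      W₁ ⊛ Σ< (m ∸ 1) (λ i → when (e ≡ᵇ d) (O ⊛ outer wZ h (suc i)))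
    ∎
  join : (T₊ ⊕ T₋) ≈ (W₁ ⊛ tShift (λ d′ → when (e ≡ᵇ d′) (O ⊛ outer wZ h m)) d)
  join = begin
      T₊ ⊕ T₋
    ≡⟨ cong₂ (λ u v → when b₊ ((oneMinusQ ^ₛ u) ⊛ (wZ (k ℕ.+ p) m ⊛ I))
                        ⊕ when b₊ ((oneMinusQ ^ₛ v) ⊛ (wZ (k ℕ.+ p ∸ 1) m ⊛ I)))
             (weight-gap-+ k W p (wt ps)) (weight-gap-+-1 k b W (wt ps) w≤W) ⟩
      when b₊ (O ⊛ (wZ (k ℕ.+ p) m ⊛ I)) ⊕ when b₊ ((oneMinusQ ^ₛ suc E) ⊛ (wZ (k ℕ.+ p ∸ 1) m ⊛ I))
    ≈⟨ when-⊕ b₊ (O ⊛ (wZ (k ℕ.+ p) m ⊛ I)) ((oneMinusQ ^ₛ suc E) ⊛ (wZ (k ℕ.+ p ∸ 1) m ⊛ I)) ⟩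
      when b₊ ((O ⊛ (wZ (k ℕ.+ p) m ⊛ I)) ⊕ ((oneMinusQ ^ₛ suc E) ⊛ (wZ (k ℕ.+ p ∸ 1) m ⊛ I)))
    ≈⟨ when-cong b₊ (merge-extensions m 1≤m a b E I) ⟩
      when b₊ (W₁ ⊛ (O ⊛ outer wZ h m))
    ≡⟨ cong (λ z → when (z ≡ᵇ d) (W₁ ⊛ (O ⊛ outer wZ h m))) (ℕP.+-∸-assoc 1 ℓ≤L) ⟩
      when (suc e ≡ᵇ d) (W₁ ⊛ (O ⊛ outer wZ h m))
    ≈⟨ when-tShift e d W₁ (O ⊛ outer wZ h m) ⟩
      W₁ ⊛ tShift (λ d′ → when (e ≡ᵇ d′) (O ⊛ outer wZ h m)) d
    ∎

ζAt-unfold : ∀ k ks m d → 1 ≤ k → All (1 ≤_) ks → 1 ≤ m → ζAt k ks m d ≈ (wZ k m ⊛ ζBelow ks m d)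
ζAt-unfold k [] m zero _ _ _ = ≈-trans (⊕-identityʳ _)
  (≈-trans (⊛-congʳ (wZ k m ⊛ 1ₛ) (≈-reflexive (cong (oneMinusQ ^ₛ_) (ℕP.n∸n≡0 (k ℕ.+ 0)))))
           (⊛-identityˡ (wZ k m ⊛ 1ₛ)))
ζAt-unfold k [] m (suc d) _ _ _ = ≈-trans (⊕-identityʳ 0ₛ) (≈-sym (⊛-zeroʳ (wZ k m)))
ζAt-unfold (suc a) (k′ ∷ ks) m d _ (1≤k′ ∷ 1≤ks) 1≤m = begin
    ζAt (suc a) (k′ ∷ ks) m d
  ≈⟨ Σl-concatMap (extZ (suc a)) (fillZ k′ ks) T ⟩
    Σl (fillZ k′ ks) (λ h → Σl (extZ (suc a) h) T)
  ≈⟨ Σl-congAll (All.map (λ {h} → extensions h) (fillZ-shape k′ ks 1≤k′ 1≤ks)) ⟩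
    Σl (fillZ k′ ks) (λ h → wZ (suc a) m ⊛ (Σ< (m ∸ 1) (α h) ⊕ tShift (β h) d))
  ≈⟨ factor-below (fillZ k′ ks) (wZ (suc a) m) (m ∸ 1) α β d ⟩
    wZ (suc a) m ⊛ ζBelow (k′ ∷ ks) m d
  ∎
  where
  open ≈-Reasoning
  L  = length ks
  W  = wt (k′ ∷ ks)
  T : List ℕ → PS
  T p = when ((length (suc a ∷ k′ ∷ ks) ∸ length p) ≡ᵇ d)
             ((oneMinusQ ^ₛ (wt (suc a ∷ k′ ∷ ks) ∸ wt p)) ⊛ outer wZ p m)
  α : List ℕ → ℕ → PS
  α h i = when ((suc L ∸ length h) ≡ᵇ d) ((oneMinusQ ^ₛ (W ∸ wt h)) ⊛ outer wZ h (suc i))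
  β : List ℕ → ℕ → PS
  β h d′ = when ((suc L ∸ length h) ≡ᵇ d′) ((oneMinusQ ^ₛ (W ∸ wt h)) ⊛ outer wZ h m)
  extensions : ∀ h → ζShape k′ L W h →
    Σl (extZ (suc a) h) T ≈ (wZ (suc a) m ⊛ (Σ< (m ∸ 1) (α h) ⊕ tShift (β h) d))
  extensions (zero  ∷ ps) (k′≤0 , _) with () ← ℕP.≤-trans 1≤k′ k′≤0
  extensions (suc b ∷ ps) (_ , ℓ≤L , w≤W) = ζAt-extensions a L W m d b ps 1≤m ℓ≤L w≤W

choices-positive : ∀ ks → All (All (1 ≤_)) (choices ks)
choices-positive []       = [] ∷ []
choices-positive (k ∷ ks) =
  concat⁺ (map⁺ (applyUpTo⁺₂ (λ i → i) k (λ i → map⁺ (All.map (s≤s z≤n ∷_) (choices-positive ks)))))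

Σl-choices : ∀ k ks (F : List ℕ → PS) →
  Σl (choices (k ∷ ks)) F ≈ Σl (upTo k) (λ i → Σl (choices ks) (λ as → F (suc i ∷ as)))
Σl-choices k ks F = ≈-trans (Σl-concatMap (λ i → map (suc i ∷_) (choices ks)) (upTo k) F)
                            (Σl-cong (upTo k) (λ i → Σl-map (suc i ∷_) (choices ks) F))

scaled-product : ∀ c₁ a₁ X c₂ a₂ Y →
  ((c₁ ·ₛ ((oneMinusQ ^ₛ a₁) ⊛ X)) ⊛ (c₂ ·ₛ ((oneMinusQ ^ₛ a₂) ⊛ Y)))
    ≈ ((c₁ ℕ.* c₂) ·ₛ ((oneMinusQ ^ₛ (a₁ ℕ.+ a₂)) ⊛ (X ⊛ Y)))
scaled-product c₁ a₁ X c₂ a₂ Y = begin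
    (c₁ ·ₛ (O₁ ⊛ X)) ⊛ (c₂ ·ₛ (O₂ ⊛ Y))
  ≈⟨ ⊛-comm (c₁ ·ₛ (O₁ ⊛ X)) (c₂ ·ₛ (O₂ ⊛ Y)) ⟩
    (c₂ ·ₛ (O₂ ⊛ Y)) ⊛ (c₁ ·ₛ (O₁ ⊛ X))
  ≈⟨ ≈-sym (·-⊛ c₁ (c₂ ·ₛ (O₂ ⊛ Y)) (O₁ ⊛ X)) ⟩
    c₁ ·ₛ ((c₂ ·ₛ (O₂ ⊛ Y)) ⊛ (O₁ ⊛ X))
  ≈⟨ ·-cong c₁ (⊛-comm (c₂ ·ₛ (O₂ ⊛ Y)) (O₁ ⊛ X)) ⟩
    c₁ ·ₛ ((O₁ ⊛ X) ⊛ (c₂ ·ₛ (O₂ ⊛ Y)))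
  ≈⟨ ·-cong c₁ (≈-sym (·-⊛ c₂ (O₁ ⊛ X) (O₂ ⊛ Y))) ⟩
    c₁ ·ₛ (c₂ ·ₛ ((O₁ ⊛ X) ⊛ (O₂ ⊛ Y)))
  ≈⟨ ≈-sym (·-* c₁ c₂ ((O₁ ⊛ X) ⊛ (O₂ ⊛ Y))) ⟩
    (c₁ ℕ.* c₂) ·ₛ ((O₁ ⊛ X) ⊛ (O₂ ⊛ Y))
  ≈⟨ ·-cong (c₁ ℕ.* c₂) (≈-trans (⊛.interchange O₁ X O₂ Y) (⊛-congʳ (X ⊛ Y) (≈-sym (^ₛ-+ oneMinusQ a₁ a₂)))) ⟩
    (c₁ ℕ.* c₂) ·ₛ ((oneMinusQ ^ₛ (a₁ ℕ.+ a₂)) ⊛ (X ⊛ Y))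
  ∎
  where
  open ≈-Reasoning
  O₁ = oneMinusQ ^ₛ a₁
  O₂ = oneMinusQ ^ₛ a₂

weight-times-below : ∀ (xs : List ℕ) ks (c : ℕ → ℕ) (e : ℕ → ℕ) (a : ℕ → ℕ) m d → 1 ≤ m → (∀ i → 1 ≤ a i) →
  (Σl xs (λ i → c i ·ₛ ((oneMinusQ ^ₛ e i) ⊛ wZ (a i) m)) ⊛
     Σl (choices ks) (λ as → binProd ks as ·ₛ ((oneMinusQ ^ₛ expSum ks as) ⊛ ζBelow as m d)))
  ≈ Σl xs (λ i → Σl (choices ks) (λ as →
      (c i ℕ.* binProd ks as) ·ₛ ((oneMinusQ ^ₛ (e i ℕ.+ expSum ks as)) ⊛ ζAt (a i) as m d)))
weight-times-below xs ks c e a m d 1≤m 1≤a =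
  ≈-trans (Σl-⊛-Σl xs (choices ks) _ _)
          (Σl-cong xs (λ i → Σl-congAll (All.map (λ {as} → term i as) (choices-positive ks))))
  where
  term : ∀ i as → All (1 ≤_) as →
    ((c i ·ₛ ((oneMinusQ ^ₛ e i) ⊛ wZ (a i) m)) ⊛ (binProd ks as ·ₛ ((oneMinusQ ^ₛ expSum ks as) ⊛ ζBelow as m d)))
      ≈ ((c i ℕ.* binProd ks as) ·ₛ ((oneMinusQ ^ₛ (e i ℕ.+ expSum ks as)) ⊛ ζAt (a i) as m d))
  term i as 1≤as = ≈-trans (scaled-product (c i) (e i) (wZ (a i) m) (binProd ks as) (expSum ks as) (ζBelow as m d))
    (·-cong (c i ℕ.* binProd ks as) (⊛-congˡ (oneMinusQ ^ₛ (e i ℕ.+ expSum ks as))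
      (≈-sym (ζAt-unfold (a i) as m d (1≤a i) 1≤as 1≤m))))

scale-below : ∀ c O (F G : ℕ → PS) N d →
  (c ·ₛ (O ⊛ (Σ< N F ⊕ tShift G d))) ≈ (Σ< N (λ j → c ·ₛ (O ⊛ F j)) ⊕ tShift (λ d′ → c ·ₛ (O ⊛ G d′)) d)
scale-below c O F G N d = begin
    c ·ₛ (O ⊛ (Σ< N F ⊕ tShift G d))
  ≈⟨ ·-cong c (⊛-distribˡ O (Σ< N F) (tShift G d)) ⟩
    c ·ₛ ((O ⊛ Σ< N F) ⊕ (O ⊛ tShift G d))
  ≈⟨ ·-⊕ c (O ⊛ Σ< N F) (O ⊛ tShift G d) ⟩
    (c ·ₛ (O ⊛ Σ< N F)) ⊕ (c ·ₛ (O ⊛ tShift G d))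
  ≈⟨ ⊕-cong (≈-trans (·-cong c (Σ<-⊛ N O F)) (Σ<-· N c (λ j → O ⊛ F j))) (scaled-tShift d) ⟩
    Σ< N (λ j → c ·ₛ (O ⊛ F j)) ⊕ tShift (λ d′ → c ·ₛ (O ⊛ G d′)) d
  ∎
  where
  open ≈-Reasoning
  scaled-tShift : ∀ d → (c ·ₛ (O ⊛ tShift G d)) ≈ tShift (λ d′ → c ·ₛ (O ⊛ G d′)) d
  scaled-tShift zero    = ≈-trans (·-cong c (⊛-zeroʳ O)) (·-zero c)
  scaled-tShift (suc d) = ≈-refl

Σl²-scale-below : ∀ {A B : Set} (xs : List A) (ys : List B) (c : A → B → ℕ) (O : A → B → PS)
  (F G : A → B → ℕ → PS) N d →
  Σl xs (λ x → Σl ys (λ y → c x y ·ₛ (O x y ⊛ (Σ< N (F x y) ⊕ tShift (G x y) d))))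
    ≈ (Σ< N (λ j → Σl xs (λ x → Σl ys (λ y → c x y ·ₛ (O x y ⊛ F x y j))))
       ⊕ tShift (λ d′ → Σl xs (λ x → Σl ys (λ y → c x y ·ₛ (O x y ⊛ G x y d′)))) d)
Σl²-scale-below xs ys c O F G N d = ≈-trans
  (Σl-cong xs (λ x → ≈-trans (Σl-cong ys (λ y → scale-below (c x y) (O x y) (F x y) (G x y) N d))
                             (Σl-split ys (λ y j → c x y ·ₛ (O x y ⊛ F x y j)) (λ y d′ → c x y ·ₛ (O x y ⊛ G x y d′)) N d)))
  (Σl-split xs (λ x j → Σl ys (λ y → c x y ·ₛ (O x y ⊛ F x y j)))
               (λ x d′ → Σl ys (λ y → c x y ·ₛ (O x y ⊛ G x y d′))) N d)

BelowExpansion : List ℕ → Set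
BelowExpansion K = ∀ m → 1 ≤ m → ∀ d →
  LiBelow K m d ≈ Σl (choices K) (λ A → binProd K A ·ₛ ((oneMinusQ ^ₛ expSum K A) ⊛ ζBelow A m d))

ζExpansionAt : ℕ → List ℕ → ℕ → ℕ → PS
ζExpansionAt k ks m d = Σl (upTo k) (λ i → Σl (choices ks) (λ as →
  (((k ∸ 1) C i) ℕ.* binProd ks as) ·ₛ ((oneMinusQ ^ₛ ((k ∸ suc i) ℕ.+ expSum ks as)) ⊛ ζAt (suc i) as m d)))

LiAt-expansion : ∀ k ks → 1 ≤ k → BelowExpansion ks → ∀ m → 1 ≤ m → ∀ d → LiAt k ks m d ≈ ζExpansionAt k ks m d
LiAt-expansion (suc k) ks _ below m 1≤m d = begin
    LiAt (suc k) ks m d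
  ≈⟨ LiAt-unfold (suc k) ks m d ⟩
    wLi (suc k) m ⊛ LiBelow ks m d
  ≈⟨ ⊛-cong (wLi-expand m 1≤m k) (below m 1≤m d) ⟩
    Σl (upTo (suc k)) (λ i → (k C i) ·ₛ ((oneMinusQ ^ₛ (k ∸ i)) ⊛ wZ (suc i) m)) ⊛
      Σl (choices ks) (λ as → binProd ks as ·ₛ ((oneMinusQ ^ₛ expSum ks as) ⊛ ζBelow as m d))
  ≈⟨ weight-times-below (upTo (suc k)) ks (k C_) (k ∸_) suc m d 1≤m (λ _ → s≤s z≤n) ⟩
    ζExpansionAt (suc k) ks m d
  ∎
  where open ≈-Reasoning

below-expansion : ∀ K → All (1 ≤_) K → BelowExpansion K
below-expansion []       _              m _   d =
  ≈-sym (≈-trans (⊕-identityʳ _) (≈-trans (1·ₛ _) (⊛-identityˡ (tOne d))))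
below-expansion (k ∷ ks) (1≤k ∷ 1≤ks) m 1≤m d = begin
    Σ< (m ∸ 1) (λ j → LiAt k ks (suc j) d) ⊕ tShift (LiAt k ks m) d
  ≈⟨ ⊕-cong (Σ<-cong (m ∸ 1) (λ j → expand (suc j) (s≤s z≤n) d)) (tShift-cong d (expand m 1≤m)) ⟩
    Σ< (m ∸ 1) (λ j → ζExpansionAt k ks (suc j) d) ⊕ tShift (ζExpansionAt k ks m) d
  ≈⟨ ≈-sym (Σl²-scale-below (upTo k) (choices ks) c O (λ i as j → ζAt (suc i) as (suc j) d)
                                                      (λ i as d′ → ζAt (suc i) as m d′) (m ∸ 1) d) ⟩
    Σl (upTo k) (λ i → Σl (choices ks) (λ as → c i as ·ₛ (O i as ⊛ ζBelow (suc i ∷ as) m d)))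
  ≈⟨ ≈-sym (Σl-choices k ks (λ A → binProd (k ∷ ks) A ·ₛ ((oneMinusQ ^ₛ expSum (k ∷ ks) A) ⊛ ζBelow A m d))) ⟩
    Σl (choices (k ∷ ks)) (λ A → binProd (k ∷ ks) A ·ₛ ((oneMinusQ ^ₛ expSum (k ∷ ks) A) ⊛ ζBelow A m d))
  ∎
  where
  open ≈-Reasoning
  expand : ∀ m → 1 ≤ m → ∀ d → LiAt k ks m d ≈ ζExpansionAt k ks m d
  expand = LiAt-expansion k ks 1≤k (below-expansion ks 1≤ks)
  c : ℕ → List ℕ → ℕ
  c i as = ((k ∸ 1) C i) ℕ.* binProd ks as
  O : ℕ → List ℕ → PS
  O i as = oneMinusQ ^ₛ ((k ∸ suc i) ℕ.+ expSum ks as)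

rhsAt : ℕ → List ℕ → ℕ → ℕ → PS
rhsAt k ks m d = Σl (upTo (k ∸ 1)) (λ i → Σl (choices ks) (λ as →
  (((k ∸ 2) C i) ℕ.* binProd ks as) ·ₛ ((oneMinusQ ^ₛ ((k ∸ (2 ℕ.+ i)) ℕ.+ expSum ks as)) ⊛ ζAt (2 ℕ.+ i) as m d)))

lemma3p12-at : ∀ k ks → 2 ≤ k → All (1 ≤_) ks → ∀ m → 1 ≤ m → ∀ d → (qpow m ⊛ LiAt k ks m d) ≈ rhsAt k ks m d
lemma3p12-at (suc zero)    ks (s≤s ()) _ _ _ _
lemma3p12-at (suc (suc k)) ks _ 1≤ks m 1≤m d = begin
    qpow m ⊛ LiAt (2 ℕ.+ k) ks m d
  ≈⟨ ⊛-congˡ (qpow m) (LiAt-unfold (2 ℕ.+ k) ks m d) ⟩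
    qpow m ⊛ (wLi (2 ℕ.+ k) m ⊛ LiBelow ks m d)
  ≈⟨ ≈-sym (⊛-assoc (qpow m) (wLi (2 ℕ.+ k) m) (LiBelow ks m d)) ⟩
    (qpow m ⊛ wLi (2 ℕ.+ k) m) ⊛ LiBelow ks m d
  ≈⟨ ⊛-cong (q-wLi-expand m 1≤m k) (below-expansion ks 1≤ks m 1≤m d) ⟩
    Σl (upTo (suc k)) (λ i → (k C i) ·ₛ ((oneMinusQ ^ₛ (k ∸ i)) ⊛ wZ (2 ℕ.+ i) m)) ⊛
      Σl (choices ks) (λ as → binProd ks as ·ₛ ((oneMinusQ ^ₛ expSum ks as) ⊛ ζBelow as m d))
  ≈⟨ weight-times-below (upTo (suc k)) ks (k C_) (k ∸_) (2 ℕ.+_) m d 1≤m (λ _ → s≤s z≤n) ⟩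
    rhsAt (2 ℕ.+ k) ks m d
  ∎
  where open ≈-Reasoning

-- The coefficient of q^N of
-- Li(q) and of ζ only involves outermost variables m₁ ≤ N (this is how Li and ζq are
-- defined), and the summands of ζ_q(p) with p₁ ≥ 2 and m₁ > n have q-order > n, so both sides of the
-- theorem are, at q^N, the partial sums over m₁ ≤ N of the identity lemma3p12-at.

Σl-coeff : ∀ {A : Set} (xs : List A) {f g : A → PS} N → All (λ x → f x N ≡ g x N) xs → Σl xs f N ≡ Σl xs g N
Σl-coeff []       N []       = refl
Σl-coeff (x ∷ xs) N (p ∷ ps) = cong₂ ℤ._+_ p (Σl-coeff xs N ps)

when-coeff : ∀ b {X Y : PS} n → X n ≡ Y n → when b X n ≡ when b Y n
when-coeff true  n eq = eq
when-coeff false n eq = refl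

⊛-coeff-agree : ∀ h f g n → (∀ j → j ≤ n → f j ≡ g j) → (h ⊛ f) n ≡ (h ⊛ g) n
⊛-coeff-agree h f g n eq = sumℤ-cong (suc n) (λ i _ → cong (h i ℤ.*_) (eq (n ∸ i) (ℕP.m∸n≤m n i)))

Σ<-stable : ∀ (F : ℕ → PS) n → (∀ i → n ≤ i → F i n ≡ + 0) → ∀ N → n ≤ N → Σ< N F n ≡ Σ< n F n
Σ<-stable F n high N n≤N = subst (λ z → Σ< z F n ≡ Σ< n F n) (ℕP.m∸n+n≡m n≤N) (extend (N ∸ n))
  where
  extend : ∀ t → Σ< (t ℕ.+ n) F n ≡ Σ< n F n
  extend zero    = refl
  extend (suc t) = trans (cong₂ ℤ._+_ (extend t) (high (t ℕ.+ n) (ℕP.m≤n+m n t))) (ℤP.+-identityʳ (Σ< n F n))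

-- q^{(p-1)(i+1)} with p ≥ 2 makes the ζ-summand at m₁ = i+1 of q-order > i.
outer-wZ-order : ∀ p ps i n → 2 ≤ p → n ≤ i → outer wZ (p ∷ ps) (suc i) n ≡ + 0
outer-wZ-order (suc zero)    ps i n (s≤s ()) _
outer-wZ-order (suc (suc p)) ps i n _ n≤i =
  trans (coeff (⊛-assoc (qpow e) (invBr (suc i) ^ₛ (2 ℕ.+ p)) (chain wZ ps (suc i))) n)
        (qpow⊛-low e ((invBr (suc i) ^ₛ (2 ℕ.+ p)) ⊛ chain wZ ps (suc i)) n (ℕP.≤-trans (s≤s n≤i) (ℕP.m≤m+n (suc i) (p ℕ.* suc i))))
  where e = suc p ℕ.* suc i

ζq-truncate : ∀ p ps → 2 ≤ p → ∀ N n → n ≤ N → ζq (p ∷ ps) n ≡ Σ< N (λ j → outer wZ (p ∷ ps) (suc j)) n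
ζq-truncate p ps 2≤p N n n≤N =
  sym (Σ<-stable (λ j → outer wZ (p ∷ ps) (suc j)) n (λ i n≤i → outer-wZ-order p ps i n 2≤p n≤i) N n≤N)

ζT-truncate : ∀ a as → 2 ≤ a → All (1 ≤_) as → ∀ d N n → n ≤ N →
  ζT a as d n ≡ Σ< N (λ j → ζAt a as (suc j) d) n
ζT-truncate a as 2≤a 1≤as d N n n≤N = begin
    ζT a as d n
  ≡⟨ coeff (sumPS-map (fillZ a as) (λ p → when (b p) (O p ⊛ ζq p))) n ⟩
    Σl (fillZ a as) (λ p → when (b p) (O p ⊛ ζq p)) n
  ≡⟨ Σl-coeff (fillZ a as) n (All.map (λ {p} → truncate p) (fillZ-shape a as (ℕP.≤-trans (s≤s z≤n) 2≤a) 1≤as)) ⟩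
    Σl (fillZ a as) (λ p → when (b p) (O p ⊛ Σ< N (λ j → outer wZ p (suc j)))) n
  ≡⟨ coeff exchange n ⟩
    Σ< N (λ j → ζAt a as (suc j) d) n
  ∎
  where
  open ≡-Reasoning
  b : List ℕ → Bool
  b p = (length (a ∷ as) ∸ length p) ≡ᵇ d
  O : List ℕ → PS
  O p = oneMinusQ ^ₛ (wt (a ∷ as) ∸ wt p)
  truncate : ∀ p → ζShape a (length as) (wt (a ∷ as)) p →
    when (b p) (O p ⊛ ζq p) n ≡ when (b p) (O p ⊛ Σ< N (λ j → outer wZ p (suc j))) n
  truncate (p₁ ∷ ps) (a≤p₁ , _) = when-coeff (b (p₁ ∷ ps)) n (⊛-coeff-agree (O (p₁ ∷ ps)) _ _ n
    (λ j j≤n → ζq-truncate p₁ ps (ℕP.≤-trans 2≤a a≤p₁) N j (ℕP.≤-trans j≤n n≤N)))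
  exchange : Σl (fillZ a as) (λ p → when (b p) (O p ⊛ Σ< N (λ j → outer wZ p (suc j))))
           ≈ Σ< N (λ j → ζAt a as (suc j) d)
  exchange = ≈-trans (Σl-cong (fillZ a as) (λ p →
               ≈-trans (when-cong (b p) (Σ<-⊛ N (O p) (λ j → outer wZ p (suc j))))
                       (when-Σ< (b p) N (λ j → O p ⊛ outer wZ p (suc j)))))
             (Σl-Σ< (fillZ a as) N (λ p j → when (b p) (O p ⊛ outer wZ p (suc j))))

LiT-as-sum : ∀ k ks d N → LiT k ks d N ≡ Σ< N (λ j → qpow (suc j) ⊛ LiAt k ks (suc j) d) N
LiT-as-sum k ks d N = begin
    LiT k ks d N
  ≡⟨ coeff (sumPS-map (fillLi k ks) (λ p → when (b p) (Li p))) N ⟩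
    Σl (fillLi k ks) (λ p → when (b p) (Li p)) N
  ≡⟨ Σl-coeff (fillLi k ks) N (All.map (λ {p} → partial p) (fillLi-shape k ks)) ⟩
    Σl (fillLi k ks) (λ p → when (b p) (Σ< N (λ j → qpow (suc j) ⊛ outer wLi p (suc j)))) N
  ≡⟨ coeff exchange N ⟩
    Σ< N (λ j → qpow (suc j) ⊛ LiAt k ks (suc j) d) N
  ∎
  where
  open ≡-Reasoning
  b : List ℕ → Bool
  b p = (length (k ∷ ks) ∸ length p) ≡ᵇ d
  partial : ∀ p → LiShape (length ks) p →
    when (b p) (Li p) N ≡ when (b p) (Σ< N (λ j → qpow (suc j) ⊛ outer wLi p (suc j))) N
  partial (p₁ ∷ ps) _ = when-coeff (b (p₁ ∷ ps)) N refl
  exchange : Σl (fillLi k ks) (λ p → when (b p) (Σ< N (λ j → qpow (suc j) ⊛ outer wLi p (suc j))))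
           ≈ Σ< N (λ j → qpow (suc j) ⊛ LiAt k ks (suc j) d)
  exchange = ≈-trans (Σl-cong (fillLi k ks) (λ p →
               ≈-trans (when-Σ< (b p) N (λ j → qpow (suc j) ⊛ outer wLi p (suc j)))
                       (Σ<-cong N (λ j → when-⊛ (b p) (qpow (suc j)) (outer wLi p (suc j))))))
    (≈-trans (Σl-Σ< (fillLi k ks) N (λ p j → qpow (suc j) ⊛ when (b p) (outer wLi p (suc j))))
             (Σ<-cong N (λ j → ≈-sym (Σl-⊛ (fillLi k ks) (qpow (suc j)) (λ p → when (b p) (outer wLi p (suc j)))))))

rhs-as-sum : ∀ k ks → All (1 ≤_) ks → ∀ d N → rhs k ks d N ≡ Σ< N (λ j → rhsAt k ks (suc j) d) N
rhs-as-sum k ks 1≤ks d N = begin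
    rhs k ks d N
  ≡⟨ coeff (sumPS-Σl (concatMap terms (upTo (k ∸ 1)))) N ⟩
    Σl (concatMap terms (upTo (k ∸ 1))) (λ x → x) N
  ≡⟨ coeff (Σl-concatMap terms (upTo (k ∸ 1)) (λ x → x)) N ⟩
    Σl (upTo (k ∸ 1)) (λ i → Σl (map (term i) (choices ks)) (λ x → x)) N
  ≡⟨ coeff (Σl-cong (upTo (k ∸ 1)) (λ i → Σl-map (term i) (choices ks) (λ x → x))) N ⟩
    Σl (upTo (k ∸ 1)) (λ i → Σl (choices ks) (term i)) N
  ≡⟨ Σl-coeff (upTo (k ∸ 1)) N (All.universal (λ i → Σl-coeff (choices ks) N
       (All.map (λ {as} → truncate i as) (choices-positive ks))) (upTo (k ∸ 1))) ⟩
    Σl (upTo (k ∸ 1)) (λ i → Σl (choices ks) (λ as → c i as ·ₛ (O i as ⊛ Σ< N (λ j → ζAt (2 ℕ.+ i) as (suc j) d)))) N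
  ≡⟨ coeff exchange N ⟩
    Σ< N (λ j → rhsAt k ks (suc j) d) N
  ∎
  where
  open ≡-Reasoning
  c : ℕ → List ℕ → ℕ
  c i as = ((k ∸ 2) C i) ℕ.* binProd ks as
  O : ℕ → List ℕ → PS
  O i as = oneMinusQ ^ₛ ((k ∸ (2 ℕ.+ i)) ℕ.+ expSum ks as)
  term : ℕ → List ℕ → PS
  term i as = c i as ·ₛ (O i as ⊛ ζT (2 ℕ.+ i) as d)
  terms : ℕ → List PS
  terms i = map (term i) (choices ks)
  truncate : ∀ i as → All (1 ≤_) as →
    term i as N ≡ (c i as ·ₛ (O i as ⊛ Σ< N (λ j → ζAt (2 ℕ.+ i) as (suc j) d))) N
  truncate i as 1≤as = cong (+ (c i as) ℤ.*_) (⊛-coeff-agree (O i as) _ _ N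
    (λ n n≤N → ζT-truncate (2 ℕ.+ i) as (s≤s (s≤s z≤n)) 1≤as d N n n≤N))
  exchange : Σl (upTo (k ∸ 1)) (λ i → Σl (choices ks) (λ as → c i as ·ₛ (O i as ⊛ Σ< N (λ j → ζAt (2 ℕ.+ i) as (suc j) d))))
           ≈ Σ< N (λ j → rhsAt k ks (suc j) d)
  exchange = ≈-trans (Σl-cong (upTo (k ∸ 1)) (λ i → ≈-trans
      (Σl-cong (choices ks) (λ as → ≈-trans (·-cong (c i as) (Σ<-⊛ N (O i as) (λ j → ζAt (2 ℕ.+ i) as (suc j) d)))
                                            (Σ<-· N (c i as) (λ j → O i as ⊛ ζAt (2 ℕ.+ i) as (suc j) d))))
      (Σl-Σ< (choices ks) N (λ as j → c i as ·ₛ (O i as ⊛ ζAt (2 ℕ.+ i) as (suc j) d)))))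
    (Σl-Σ< (upTo (k ∸ 1)) N (λ i j → Σl (choices ks) (λ as → c i as ·ₛ (O i as ⊛ ζAt (2 ℕ.+ i) as (suc j) d))))

lemma3p12 : (k₁ : ℕ) (ks : List ℕ) → 2 ≤ k₁ → All (1 ≤_) ks →
            (d N : ℕ) → LiT k₁ ks d N ≡ rhs k₁ ks d N
lemma3p12 k₁ ks 2≤k₁ 1≤ks d N = begin
    LiT k₁ ks d N
  ≡⟨ LiT-as-sum k₁ ks d N ⟩
    Σ< N (λ j → qpow (suc j) ⊛ LiAt k₁ ks (suc j) d) N
  ≡⟨ coeff (Σ<-cong N (λ j → lemma3p12-at k₁ ks 2≤k₁ 1≤ks (suc j) (s≤s z≤n) d)) N ⟩
    Σ< N (λ j → rhsAt k₁ ks (suc j) d) N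
  ≡⟨ sym (rhs-as-sum k₁ ks 1≤ks d N) ⟩
    rhs k₁ ks d N
  ∎
  where open ≡-Reasoning
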